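{- Let $\mathbb{F}_q$ be a finite field of characteristic $p \neq 2$, let $f(x) \in \mathbb{F}_q[x]$ be an irreducible polynomial, and let $N : y^2 = x f(x)^2$. Let $h_1(x), h_2(x) \in \mathbb{F}_q[x]$ satisfy $\deg(h_i(x)) < \deg(f(x))$ and $\gcd(f(x), x - h_i(x)^2) = 1$ for $i = 1,2$, and let $$D_1 = [f(x)^2,\, h_1(x) f(x)], \qquad D_2 = [f(x)^2,\, h_2(x) f(x)]$$ be the corresponding divisor classes in $\mathrm{Jac}(N)$. If $h_1(x) \neq h_2(x)$, then $D_1 \neq D_2$.
   Context: $\mathrm{Jac}(N)$ denotes the (generalized) Jacobian of $N$, i.e. the ideal class group of the coordinate ring $\mathbb{F}_q[x,y]/(y^2 - x f(x)^2)$. Divisor classes on a curve $y^2 = F(x)$ are described by the extended Mumford representation: a pair of polynomials $[u(x), v(x)]$ represents a divisor class (the class of the ideal $(u(x), y - v(x))$) if (i) $\deg v < \deg u$; (ii) $u(x)$ divides $v(x)^2 - F(x)$; (iii) whenever $u(x)$ and $v(x)$ are both divisible by $x-a$ for a multiple root $a$ of $F(x)$, the polynomial $(F(x) - v(x)^2)/u(x)$ is not divisible by $x-a$. The identity class is $[1,0]$. -}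

module Defs where

open import Level using (Level; _⊔_; suc)
open import Algebra.Bundles using (CommutativeRing)
open import Data.Nat using (ℕ; zero; suc; _≤_)
open import Data.List using (List; []; _∷_; map)
open import Data.List.Relation.Unary.Any using (Any)
open import Data.Product using (Σ; ∃; _×_; _,_; proj₁; proj₂)
open import Relation.Nullary using (¬_)

record FiniteField (c ℓ : Level) : Set (Level.suc (c ⊔ ℓ)) where
  field
    commRing : CommutativeRing c ℓ
  open CommutativeRing commRing public
  field
    nontrivial : ¬ (1# ≈ 0#)
    inverse    : ∀ x → ¬ (x ≈ 0#) → ∃ λ y → x * y ≈ 1#
    finite     : ∃ λ (xs : List Carrier) → ∀ x → Any (x ≈_) xs

module _ {c ℓ : Level} (F : FiniteField c ℓ) where
  open FiniteField F

  CharNot2 : Set ℓ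
  CharNot2 = ¬ (1# + 1# ≈ 0#)

  -- Polynomials F_q[x] as coefficient lists (constant term first),
  -- compared coefficientwise (so trailing zeros are irrelevant).
  Poly : Set c
  Poly = List Carrier

  coeff : Poly → ℕ → Carrier
  coeff []      _       = 0#
  coeff (a ∷ p) zero    = a
  coeff (a ∷ p) (suc n) = coeff p n

  _≋_ : Poly → Poly → Set ℓ
  p ≋ q = ∀ n → coeff p n ≈ coeff q n

  _+P_ : Poly → Poly → Poly
  []      +P q       = q
  (a ∷ p) +P []      = a ∷ p
  (a ∷ p) +P (b ∷ q) = (a + b) ∷ (p +P q)

  -P_ : Poly → Poly
  -P p = map -_ p

  _·P_ : Carrier → Poly → Poly
  a ·P p = map (a *_) p

  _*P_ : Poly → Poly → Poly
  []      *P q = []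
  (a ∷ p) *P q = (a ·P q) +P (0# ∷ (p *P q))

  0P 1P xP : Poly
  0P = []
  1P = 1# ∷ []
  xP = 0# ∷ 1# ∷ []

  UnitP : Poly → Set (c ⊔ ℓ)
  UnitP u = ∃ λ v → (u *P v) ≋ 1P

  _∣P_ : Poly → Poly → Set (c ⊔ ℓ)
  d ∣P p = ∃ λ e → (d *P e) ≋ p

  Irreducible : Poly → Set (c ⊔ ℓ)
  Irreducible f = ¬ (f ≋ 0P) × ¬ UnitP f
                × (∀ a b → f ≋ (a *P b) → UnitP a Data.Sum.⊎ UnitP b)
    where import Data.Sum

  GcdOne : Poly → Poly → Set (c ⊔ ℓ)
  GcdOne f g = ∀ d → d ∣P f → d ∣P g → UnitP d

  -- deg h < deg f  (with deg 0 = -∞): there is an index d with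
  -- coeff f d ≠ 0 such that all coefficients of h from index d on vanish.
  DegLt : Poly → Poly → Set ℓ
  DegLt h f = ∃ λ d → ¬ (coeff f d ≈ 0#) × (∀ j → d ≤ j → coeff h j ≈ 0#)

  -- Coordinate ring  F_q[x,y]/(y^2 - P(x)),  elements a(x) + b(x) y
  -- represented by pairs (a , b); this representation is unique.
  module Coord (P : Poly) where
    Elt : Set c
    Elt = Poly × Poly

    _≈R_ : Elt → Elt → Set ℓ
    (a , b) ≈R (a' , b') = (a ≋ a') × (b ≋ b')

    _+R_ : Elt → Elt → Elt
    (a , b) +R (a' , b') = (a +P a') , (b +P b')

    _*R_ : Elt → Elt → Elt
    (a , b) *R (a' , b') = ((a *P a') +P (P *P (b *P b'))) , ((a *P b') +P (b *P a'))

    0R : Elt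
    0R = 0P , 0P

    InIdeal₂ : Elt → Elt → Elt → Set (c ⊔ ℓ)
    InIdeal₂ g₁ g₂ z = ∃ λ r → ∃ λ s → ((r *R g₁) +R (s *R g₂)) ≈R z

    SameIdeal : Elt → Elt → Elt → Elt → Set (c ⊔ ℓ)
    SameIdeal g₁ g₂ h₁ h₂ =
      (InIdeal₂ h₁ h₂ g₁ × InIdeal₂ h₁ h₂ g₂) × (InIdeal₂ g₁ g₂ h₁ × InIdeal₂ g₁ g₂ h₂)

    -- Mumford pair [u, v] ↦ ideal (u(x), y - v(x)); generators:
    gen₁ gen₂ : Poly → Poly → Elt
    gen₁ u v = u , 0P
    gen₂ u v = (-P v) , 1P

    SameClass : Poly → Poly → Poly → Poly → Set (c ⊔ ℓ)
    SameClass u v u' v' = ∃ λ α → ∃ λ β → ¬ (α ≈R 0R) × ¬ (β ≈R 0R) ×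
      SameIdeal (α *R gen₁ u v) (α *R gen₂ u v) (β *R gen₁ u' v') (β *R gen₂ u' v')

  -- The curve N : y^2 = x f(x)^2, and equality of divisor classes in Jac(N)
  -- (the ideal class group of its coordinate ring).
  NPoly : Poly → Poly
  NPoly f = xP *P (f *P f)

  ClassEqN : Poly → Poly → Poly → Poly → Poly → Set (c ⊔ ℓ)
  ClassEqN f u v u' v' = Coord.SameClass (NPoly f) u v u' v'

-- Embed the coordinate ring R of N : y² = x f² into O = F[x][w]/(w² − x) by y ↦ f w.
-- O is a domain whose units are the nonzero constants, because in the norm a² − x b² the
-- degrees of a² (even) and x b² (odd) cannot cancel. If α D₁ = β D₂, write A, B for the
-- images of α, β. That α f² and α (y − h₁ f) lie in β (f², y − h₂ f) gives B Y = A f and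
-- B X = A (w − h₁), hence Y (w − h₁) = f X; since f is prime to x − h₁², f divides Y and
-- so B U = A. Symmetrically A V = B, so U is a unit, a constant c, and X = c (w − h₁).
-- Evaluating w ↦ h₂ on X shows f ∣ c (h₂ − h₁), impossible for h₁ ≠ h₂ of degree < deg f.
module Submission where

open import Algebra using (CommutativeRing)
open import Level using (Level; _⊔_)
open import Data.Nat as ℕ using (ℕ; zero; suc)
open import Data.List using ([]; _∷_)
open import Data.Product using (Σ; ∃; _,_; proj₁; proj₂)
open import Data.Empty using (⊥; ⊥-elim)
open import Relation.Nullary using (¬_; Dec; yes; no)
open import Relation.Nullary.Negation using (DoubleNegation; ¬¬-map; negated-stable; contradiction)
open import Relation.Nullary.Decidable using (¬¬-excluded-middle)
import Relation.Binary.Reasoning.Setoid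
open import Defs

-- Equality of field elements is not decidable, so case distinctions on it are made in the
-- double-negation monad; this is harmless because the theorem is a negation.
infixl 1 _>>=_
_>>=_ : ∀ {a b} {A : Set a} {B : Set b} → DoubleNegation A → (A → DoubleNegation B) → DoubleNegation B
¬¬a >>= f = negated-stable (¬¬-map f ¬¬a)

return : ∀ {a} {A : Set a} → A → DoubleNegation A
return = contradiction

decide : ∀ {a} (A : Set a) → DoubleNegation (Dec A)
decide A = ¬¬-excluded-middle

-- Tactic.RingSolver would need a zero test on the carrier; integer coefficients avoid it.
module IntegerCoefficientSolver {c ℓ : Level} (R : CommutativeRing c ℓ) where
  open CommutativeRing R
  open import Algebra.Properties.Ring ring
    using (-‿distribˡ-*; -‿distribʳ-*; -‿involutive; -0#≈0#; -‿+-comm)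
  open import Algebra.Properties.Semiring.Mult semiring using (_×_; ×-homo-+; ×1-homo-*)
  open import Algebra.Solver.Ring.AlmostCommutativeRing
  open import Data.Nat using (z≤n)
  open import Data.Integer as ℤ using (ℤ; +_; -[1+_]; _⊖_)
  import Data.Integer.Properties as ℤ
  open import Data.Sign as Sign using (Sign)
  open import Data.Maybe using (Maybe; just; nothing)
  open import Relation.Binary.PropositionalEquality using (cong)
  import Relation.Binary.PropositionalEquality as ≡
  open import Algebra.Properties.CommutativeSemigroup +-commutativeSemigroup
    using (interchange; x∙yz≈y∙xz)
  open import Relation.Binary.Reasoning.Setoid setoid

  ⟦_⟧ℤ : ℤ → Carrier
  ⟦ + n ⟧ℤ      = n × 1#
  ⟦ -[1+ n ] ⟧ℤ = - (suc n × 1#)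

  signed : Sign → Carrier → Carrier
  signed Sign.+ x = x
  signed Sign.- x = - x

  signed-cong : ∀ s {x y} → x ≈ y → signed s x ≈ signed s y
  signed-cong Sign.+ x≈y = x≈y
  signed-cong Sign.- x≈y = -‿cong x≈y

  signed-* : ∀ s t x y → signed (s Sign.* t) (x * y) ≈ signed s x * signed t y
  signed-* Sign.+ Sign.+ x y = refl
  signed-* Sign.+ Sign.- x y = -‿distribʳ-* x y
  signed-* Sign.- Sign.+ x y = -‿distribˡ-* x y
  signed-* Sign.- Sign.- x y = begin
    x * y          ≈⟨ -‿involutive (x * y) ⟨
    - - (x * y)    ≈⟨ -‿cong (-‿distribʳ-* x y) ⟩
    - (x * - y)    ≈⟨ -‿distribˡ-* x (- y) ⟩
    - x * - y      ∎

  ⟦◃⟧ : ∀ s n → ⟦ s ℤ.◃ n ⟧ℤ ≈ signed s (n × 1#)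
  ⟦◃⟧ Sign.+ zero    = refl
  ⟦◃⟧ Sign.- zero    = sym -0#≈0#
  ⟦◃⟧ Sign.+ (suc n) = refl
  ⟦◃⟧ Sign.- (suc n) = refl

  ⟦⟧ℤ-signed : ∀ i → ⟦ i ⟧ℤ ≈ signed (ℤ.sign i) (ℤ.∣ i ∣ × 1#)
  ⟦⟧ℤ-signed (+ n)    = refl
  ⟦⟧ℤ-signed -[1+ n ] = refl

  ⟦⟧ℤ-homo-* : ∀ i j → ⟦ i ℤ.* j ⟧ℤ ≈ ⟦ i ⟧ℤ * ⟦ j ⟧ℤ
  ⟦⟧ℤ-homo-* i j = begin
    ⟦ i ℤ.* j ⟧ℤ                                   ≈⟨ ⟦◃⟧ (s Sign.* t) (m ℕ.* n) ⟩
    signed (s Sign.* t) ((m ℕ.* n) × 1#)           ≈⟨ signed-cong (s Sign.* t) (×1-homo-* m n) ⟩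
    signed (s Sign.* t) ((m × 1#) * (n × 1#))      ≈⟨ signed-* s t (m × 1#) (n × 1#) ⟩
    signed s (m × 1#) * signed t (n × 1#)          ≈⟨ *-cong (⟦⟧ℤ-signed i) (⟦⟧ℤ-signed j) ⟨
    ⟦ i ⟧ℤ * ⟦ j ⟧ℤ                                ∎
    where
    s t : Sign
    s = ℤ.sign i ; t = ℤ.sign j
    m n : ℕ
    m = ℤ.∣ i ∣ ; n = ℤ.∣ j ∣

  ⟦⟧ℤ-homo-neg : ∀ i → ⟦ ℤ.- i ⟧ℤ ≈ - ⟦ i ⟧ℤ
  ⟦⟧ℤ-homo-neg -[1+ n ]  = sym (-‿involutive _)
  ⟦⟧ℤ-homo-neg (+ zero)  = sym -0#≈0#
  ⟦⟧ℤ-homo-neg (+ suc n) = refl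

  ⟦⊖⟧ : ∀ m n → ⟦ m ⊖ n ⟧ℤ ≈ m × 1# - n × 1#
  ⟦⊖⟧ m       zero    = begin
    ⟦ m ⊖ 0 ⟧ℤ  ≡⟨ cong ⟦_⟧ℤ (ℤ.⊖-≥ (z≤n {m})) ⟩
    m × 1#      ≈⟨ +-identityʳ (m × 1#) ⟨
    m × 1# + 0# ≈⟨ +-congˡ -0#≈0# ⟨
    m × 1# - 0# ∎
  ⟦⊖⟧ zero    (suc n) = begin
    ⟦ 0 ⊖ suc n ⟧ℤ    ≡⟨ cong ⟦_⟧ℤ (ℤ.⊖-≤ (z≤n {suc n})) ⟩
    - (suc n × 1#)    ≈⟨ +-identityˡ _ ⟨
    0# - suc n × 1#   ∎
  ⟦⊖⟧ (suc m) (suc n) = begin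
    ⟦ suc m ⊖ suc n ⟧ℤ                ≡⟨ cong ⟦_⟧ℤ (ℤ.[1+m]⊖[1+n]≡m⊖n m n) ⟩
    ⟦ m ⊖ n ⟧ℤ                        ≈⟨ ⟦⊖⟧ m n ⟩
    a - b                             ≈⟨ +-identityˡ (a - b) ⟨
    0# + (a - b)                      ≈⟨ +-congʳ (-‿inverseʳ 1#) ⟨
    (1# - 1#) + (a - b)               ≈⟨ interchange 1# (- 1#) a (- b) ⟩
    (1# + a) + (- 1# + - b)           ≈⟨ +-congˡ (-‿+-comm 1# b) ⟩
    (1# + a) - (1# + b)               ∎
    where
    a b : Carrier
    a = m × 1# ; b = n × 1#

  ⟦⟧ℤ-homo-+ : ∀ i j → ⟦ i ℤ.+ j ⟧ℤ ≈ ⟦ i ⟧ℤ + ⟦ j ⟧ℤ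
  ⟦⟧ℤ-homo-+ (+ m)    (+ n)    = ×-homo-+ 1# m n
  ⟦⟧ℤ-homo-+ (+ m)    -[1+ n ] = ⟦⊖⟧ m (suc n)
  ⟦⟧ℤ-homo-+ -[1+ m ] (+ n)    = trans (⟦⊖⟧ n (suc m)) (+-comm _ _)
  ⟦⟧ℤ-homo-+ -[1+ m ] -[1+ n ] = begin
    - (suc (suc (m ℕ.+ n)) × 1#)        ≈⟨ -‿cong (+-congˡ (×-homo-+ 1# (suc m) n)) ⟩
    - (1# + (suc m × 1# + n × 1#))      ≈⟨ -‿cong (x∙yz≈y∙xz 1# (suc m × 1#) (n × 1#)) ⟩
    - (suc m × 1# + suc n × 1#)         ≈⟨ -‿+-comm _ _ ⟨
    - (suc m × 1#) + - (suc n × 1#)     ∎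

  ℤ-homomorphism : ℤ.+-*-rawRing -Raw-AlmostCommutative⟶ fromCommutativeRing R
  ℤ-homomorphism = record
    { ⟦_⟧ = ⟦_⟧ℤ ; +-homo = ⟦⟧ℤ-homo-+ ; *-homo = ⟦⟧ℤ-homo-* ; -‿homo = ⟦⟧ℤ-homo-neg
    ; 0-homo = refl ; 1-homo = +-identityʳ 1# }

  ≟-witness : ∀ i j → Maybe (⟦ i ⟧ℤ ≈ ⟦ j ⟧ℤ)
  ≟-witness i j with i ℤ.≟ j
  ... | yes ≡.refl = just refl
  ... | no _       = nothing

  open import Algebra.Solver.Ring ℤ.+-*-rawRing (fromCommutativeRing R) ℤ-homomorphism ≟-witness public

module Polynomials {c ℓ : Level} (F : FiniteField c ℓ) where
  open FiniteField F
  open import Algebra.Properties.Ring ring using (-0#≈0#)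
  open import Algebra.Properties.CommutativeSemigroup +-commutativeSemigroup using (x∙yz≈y∙xz)
  open import Algebra.Properties.Group +-group using (x∙y⁻¹≈ε⇒x≈y)
  open Relation.Binary.Reasoning.Setoid setoid
  open IntegerCoefficientSolver commRing using (solve; _:=_; _:+_; _:*_)

  infixl 6 _+ₚ_
  infixl 7 _*ₚ_ _·ₚ_
  infix  8 -ₚ_
  infix  4 _≈ₚ_

  _+ₚ_ _*ₚ_ : Poly F → Poly F → Poly F
  _+ₚ_ = _+P_ F
  _*ₚ_ = _*P_ F

  -ₚ_ : Poly F → Poly F
  -ₚ_ = -P_ F

  _·ₚ_ : Carrier → Poly F → Poly F
  _·ₚ_ = _·P_ F

  -- A record rather than _≋_ itself, so that both sides are inferable from a proof.
  record _≈ₚ_ (p q : Poly F) : Set ℓ where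
    constructor coeffwise
    field at : ∀ n → coeff F p n ≈ coeff F q n
  open _≈ₚ_ public

  ≈ₚ-refl : ∀ {p} → p ≈ₚ p
  ≈ₚ-refl = coeffwise λ _ → refl

  ≈ₚ-sym : ∀ {p q} → p ≈ₚ q → q ≈ₚ p
  ≈ₚ-sym p≈q = coeffwise λ n → sym (at p≈q n)

  ≈ₚ-trans : ∀ {p q r} → p ≈ₚ q → q ≈ₚ r → p ≈ₚ r
  ≈ₚ-trans p≈q q≈r = coeffwise λ n → trans (at p≈q n) (at q≈r n)

  ∷-cong : ∀ {a b p q} → a ≈ b → p ≈ₚ q → (a ∷ p) ≈ₚ (b ∷ q)
  ∷-cong {a} {b} {p} {q} a≈b p≈q = coeffwise λ where
    zero    → a≈b
    (suc n) → at p≈q n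

  tail-≈ₚ : ∀ {a b p q} → (a ∷ p) ≈ₚ (b ∷ q) → p ≈ₚ q
  tail-≈ₚ e = coeffwise λ n → at e (suc n)

  tail-≈ₚ[] : ∀ {a p} → (a ∷ p) ≈ₚ [] → p ≈ₚ []
  tail-≈ₚ[] e = coeffwise λ n → at e (suc n)

  ∷0-≈ₚ[] : ∀ {p} → p ≈ₚ [] → (0# ∷ p) ≈ₚ []
  ∷0-≈ₚ[] p≈0 = coeffwise λ where
    zero    → refl
    (suc n) → at p≈0 n

  coeff-+ : ∀ p q n → coeff F (p +ₚ q) n ≈ coeff F p n + coeff F q n
  coeff-+ []      q       n       = sym (+-identityˡ _)
  coeff-+ (a ∷ p) []      n       = sym (+-identityʳ _)
  coeff-+ (a ∷ p) (b ∷ q) zero    = refl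
  coeff-+ (a ∷ p) (b ∷ q) (suc n) = coeff-+ p q n

  coeff-neg : ∀ p n → coeff F (-ₚ p) n ≈ - coeff F p n
  coeff-neg []      n       = sym -0#≈0#
  coeff-neg (a ∷ p) zero    = refl
  coeff-neg (a ∷ p) (suc n) = coeff-neg p n

  coeff-· : ∀ a p n → coeff F (a ·ₚ p) n ≈ a * coeff F p n
  coeff-· a []      n       = sym (zeroʳ a)
  coeff-· a (b ∷ p) zero    = refl
  coeff-· a (b ∷ p) (suc n) = coeff-· a p n

  coeff-shift-[] : ∀ n → coeff F (0# ∷ []) n ≈ 0#
  coeff-shift-[] zero    = refl
  coeff-shift-[] (suc n) = refl

  coeff-shift-+ : ∀ p q n → coeff F (0# ∷ (p +ₚ q)) n ≈ coeff F (0# ∷ p) n + coeff F (0# ∷ q) n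
  coeff-shift-+ p q zero    = sym (+-identityˡ 0#)
  coeff-shift-+ p q (suc n) = coeff-+ p q n

  coeff-shift-· : ∀ a p n → coeff F (0# ∷ (a ·ₚ p)) n ≈ a * coeff F (0# ∷ p) n
  coeff-shift-· a p zero    = sym (zeroʳ a)
  coeff-shift-· a p (suc n) = coeff-· a p n

  coeff-∷* : ∀ a p q n → coeff F ((a ∷ p) *ₚ q) n ≈ a * coeff F q n + coeff F (0# ∷ (p *ₚ q)) n
  coeff-∷* a p q n = trans (coeff-+ (a ·ₚ q) (0# ∷ (p *ₚ q)) n) (+-congʳ (coeff-· a q n))

  coeff-sub : ∀ p q n → coeff F (p +ₚ -ₚ q) n ≈ coeff F p n - coeff F q n
  coeff-sub p q n = trans (coeff-+ p (-ₚ q) n) (+-congˡ (coeff-neg q n))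

  coeff-sub≈0 : ∀ p q {j} → coeff F p j ≈ 0# → coeff F q j ≈ 0# → coeff F (p +ₚ -ₚ q) j ≈ 0#
  coeff-sub≈0 p q {j} p_j≈0 q_j≈0 = trans (coeff-sub p q j) (trans (+-cong p_j≈0 (-‿cong q_j≈0)) (-‿inverseʳ 0#))

  p-q≈[]⇒p≈q : ∀ {p q} → p +ₚ -ₚ q ≈ₚ [] → p ≈ₚ q
  p-q≈[]⇒p≈q {p} {q} p-q≈0 = coeffwise λ n → x∙y⁻¹≈ε⇒x≈y _ _ (trans (sym (coeff-sub p q n)) (at p-q≈0 n))

  +ₚ-cong : ∀ {p p′ q q′} → p ≈ₚ p′ → q ≈ₚ q′ → p +ₚ q ≈ₚ p′ +ₚ q′
  +ₚ-cong {p} {p′} {q} {q′} p≈p′ q≈q′ = coeffwise λ n → begin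
    coeff F (p +ₚ q) n            ≈⟨ coeff-+ p q n ⟩
    coeff F p n + coeff F q n     ≈⟨ +-cong (at p≈p′ n) (at q≈q′ n) ⟩
    coeff F p′ n + coeff F q′ n   ≈⟨ coeff-+ p′ q′ n ⟨
    coeff F (p′ +ₚ q′) n          ∎

  +ₚ-congˡ : ∀ p {q q′} → q ≈ₚ q′ → p +ₚ q ≈ₚ p +ₚ q′
  +ₚ-congˡ p = +ₚ-cong (≈ₚ-refl {p})

  +ₚ-congʳ : ∀ {p p′} q → p ≈ₚ p′ → p +ₚ q ≈ₚ p′ +ₚ q
  +ₚ-congʳ q p≈p′ = +ₚ-cong p≈p′ (≈ₚ-refl {q})

  +ₚ-assoc : ∀ p q r → (p +ₚ q) +ₚ r ≈ₚ p +ₚ (q +ₚ r)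
  +ₚ-assoc p q r = coeffwise λ n → begin
    coeff F ((p +ₚ q) +ₚ r) n                      ≈⟨ trans (coeff-+ (p +ₚ q) r n) (+-congʳ (coeff-+ p q n)) ⟩
    (coeff F p n + coeff F q n) + coeff F r n      ≈⟨ +-assoc _ _ _ ⟩
    coeff F p n + (coeff F q n + coeff F r n)      ≈⟨ trans (coeff-+ p (q +ₚ r) n) (+-congˡ (coeff-+ q r n)) ⟨
    coeff F (p +ₚ (q +ₚ r)) n                      ∎

  +ₚ-comm : ∀ p q → p +ₚ q ≈ₚ q +ₚ p
  +ₚ-comm p q = coeffwise λ n → trans (coeff-+ p q n) (trans (+-comm _ _) (sym (coeff-+ q p n)))

  +ₚ-identityʳ : ∀ p → p +ₚ [] ≈ₚ p
  +ₚ-identityʳ p = coeffwise λ n → trans (coeff-+ p [] n) (+-identityʳ _)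

  -ₚ-cong : ∀ {p q} → p ≈ₚ q → -ₚ p ≈ₚ -ₚ q
  -ₚ-cong {p} {q} p≈q = coeffwise λ n → trans (coeff-neg p n) (trans (-‿cong (at p≈q n)) (sym (coeff-neg q n)))

  -ₚ-inverseˡ : ∀ p → -ₚ p +ₚ p ≈ₚ []
  -ₚ-inverseˡ p = coeffwise λ n → trans (coeff-+ (-ₚ p) p n) (trans (+-congʳ (coeff-neg p n)) (-‿inverseˡ _))

  -ₚ-inverseʳ : ∀ p → p +ₚ -ₚ p ≈ₚ []
  -ₚ-inverseʳ p = ≈ₚ-trans (+ₚ-comm p (-ₚ p)) (-ₚ-inverseˡ p)

  ·ₚ-cong : ∀ {a b p q} → a ≈ b → p ≈ₚ q → a ·ₚ p ≈ₚ b ·ₚ q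
  ·ₚ-cong {a} {b} {p} {q} a≈b p≈q = coeffwise λ n →
    trans (coeff-· a p n) (trans (*-cong a≈b (at p≈q n)) (sym (coeff-· b q n)))

  *ₚ-zeroʳ : ∀ p → p *ₚ [] ≈ₚ []
  *ₚ-zeroʳ []      = ≈ₚ-refl
  *ₚ-zeroʳ (a ∷ p) = ∷0-≈ₚ[] (*ₚ-zeroʳ p)

  p≈[]⇒p*ₚq≈[] : ∀ {p} q → p ≈ₚ [] → p *ₚ q ≈ₚ []
  p≈[]⇒p*ₚq≈[] {[]}    q p≈0 = ≈ₚ-refl
  p≈[]⇒p*ₚq≈[] {a ∷ p} q p≈0 = coeffwise λ n → begin
    coeff F ((a ∷ p) *ₚ q) n                    ≈⟨ coeff-∷* a p q n ⟩
    a * coeff F q n + coeff F (0# ∷ (p *ₚ q)) n ≈⟨ +-cong (*-congʳ (at p≈0 0)) (at (∷0-≈ₚ[] (p≈[]⇒p*ₚq≈[] q (tail-≈ₚ[] p≈0))) n) ⟩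
    0# * coeff F q n + 0#                       ≈⟨ +-congʳ (zeroˡ _) ⟩
    0# + 0#                                     ≈⟨ +-identityʳ 0# ⟩
    0#                                          ∎

  *ₚ-congˡ : ∀ {p p′} q → p ≈ₚ p′ → p *ₚ q ≈ₚ p′ *ₚ q
  *ₚ-congˡ {[]}    {p′}     q p≈p′ = ≈ₚ-sym (p≈[]⇒p*ₚq≈[] q (≈ₚ-sym p≈p′))
  *ₚ-congˡ {a ∷ p} {[]}     q p≈p′ = p≈[]⇒p*ₚq≈[] q p≈p′
  *ₚ-congˡ {a ∷ p} {b ∷ p′} q p≈p′ =
    +ₚ-cong (·ₚ-cong (at p≈p′ 0) ≈ₚ-refl) (∷-cong refl (*ₚ-congˡ q (tail-≈ₚ p≈p′)))

  *ₚ-congʳ : ∀ p {q q′} → q ≈ₚ q′ → p *ₚ q ≈ₚ p *ₚ q′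
  *ₚ-congʳ []      q≈q′ = ≈ₚ-refl
  *ₚ-congʳ (a ∷ p) q≈q′ = +ₚ-cong (·ₚ-cong refl q≈q′) (∷-cong refl (*ₚ-congʳ p q≈q′))

  *ₚ-cong : ∀ {p p′ q q′} → p ≈ₚ p′ → q ≈ₚ q′ → p *ₚ q ≈ₚ p′ *ₚ q′
  *ₚ-cong {p} {p′} {q} p≈p′ q≈q′ = ≈ₚ-trans (*ₚ-congˡ q p≈p′) (*ₚ-congʳ p′ q≈q′)

  *ₚ-distribˡ-+ₚ : ∀ p q r → p *ₚ (q +ₚ r) ≈ₚ p *ₚ q +ₚ p *ₚ r
  *ₚ-distribˡ-+ₚ []      q r = ≈ₚ-refl
  *ₚ-distribˡ-+ₚ (a ∷ p) q r = coeffwise coeff-distrib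
    where
    coeff-distrib : ∀ n → coeff F ((a ∷ p) *ₚ (q +ₚ r)) n ≈ coeff F ((a ∷ p) *ₚ q +ₚ (a ∷ p) *ₚ r) n
    coeff-distrib n = begin
      coeff F ((a ∷ p) *ₚ (q +ₚ r)) n                     ≈⟨ coeff-∷* a p (q +ₚ r) n ⟩
      a * coeff F (q +ₚ r) n + coeff F (0# ∷ (p *ₚ (q +ₚ r))) n
        ≈⟨ +-cong (*-congˡ (coeff-+ q r n))
                  (trans (at (∷-cong refl (*ₚ-distribˡ-+ₚ p q r)) n) (coeff-shift-+ (p *ₚ q) (p *ₚ r) n)) ⟩
      a * (x + y) + (u + v)
        ≈⟨ solve 5 (λ a x y u v → a :* (x :+ y) :+ (u :+ v) := (a :* x :+ u) :+ (a :* y :+ v)) refl a x y u v ⟩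
      (a * x + u) + (a * y + v)                           ≈⟨ +-cong (coeff-∷* a p q n) (coeff-∷* a p r n) ⟨
      coeff F ((a ∷ p) *ₚ q) n + coeff F ((a ∷ p) *ₚ r) n ≈⟨ coeff-+ ((a ∷ p) *ₚ q) ((a ∷ p) *ₚ r) n ⟨
      coeff F ((a ∷ p) *ₚ q +ₚ (a ∷ p) *ₚ r) n            ∎
      where
      x = coeff F q n ; y = coeff F r n
      u = coeff F (0# ∷ (p *ₚ q)) n ; v = coeff F (0# ∷ (p *ₚ r)) n

  *ₚ-∷ʳ : ∀ p b q → p *ₚ (b ∷ q) ≈ₚ b ·ₚ p +ₚ (0# ∷ (p *ₚ q))
  *ₚ-∷ʳ []      b q = coeffwise λ where
    zero    → refl
    (suc n) → refl
  *ₚ-∷ʳ (a ∷ p) b q = coeffwise λ where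
    zero    → +-congʳ (*-comm a b)
    (suc n) → begin
      coeff F ((a ∷ p) *ₚ (b ∷ q)) (suc n)
        ≈⟨ coeff-∷* a p (b ∷ q) (suc n) ⟩
      a * coeff F q n + coeff F (p *ₚ (b ∷ q)) n
        ≈⟨ +-congˡ (trans (at (*ₚ-∷ʳ p b q) n) (trans (coeff-+ (b ·ₚ p) (0# ∷ (p *ₚ q)) n) (+-congʳ (coeff-· b p n)))) ⟩
      a * coeff F q n + (b * coeff F p n + coeff F (0# ∷ (p *ₚ q)) n)
        ≈⟨ x∙yz≈y∙xz _ _ _ ⟩
      b * coeff F p n + (a * coeff F q n + coeff F (0# ∷ (p *ₚ q)) n)
        ≈⟨ +-congˡ (coeff-∷* a p q n) ⟨
      b * coeff F p n + coeff F ((a ∷ p) *ₚ q) n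
        ≈⟨ trans (coeff-+ (b ·ₚ (a ∷ p)) (0# ∷ ((a ∷ p) *ₚ q)) (suc n)) (+-congʳ (coeff-· b p n)) ⟨
      coeff F (b ·ₚ (a ∷ p) +ₚ (0# ∷ ((a ∷ p) *ₚ q))) (suc n) ∎

  *ₚ-comm : ∀ p q → p *ₚ q ≈ₚ q *ₚ p
  *ₚ-comm []      q = ≈ₚ-sym (*ₚ-zeroʳ q)
  *ₚ-comm (a ∷ p) q = ≈ₚ-trans (+ₚ-cong ≈ₚ-refl (∷-cong refl (*ₚ-comm p q))) (≈ₚ-sym (*ₚ-∷ʳ q a p))

  *ₚ-distribʳ-+ₚ : ∀ r p q → (p +ₚ q) *ₚ r ≈ₚ p *ₚ r +ₚ q *ₚ r
  *ₚ-distribʳ-+ₚ r p q = ≈ₚ-trans (*ₚ-comm (p +ₚ q) r)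
    (≈ₚ-trans (*ₚ-distribˡ-+ₚ r p q) (+ₚ-cong (*ₚ-comm r p) (*ₚ-comm r q)))

  ·ₚ-assoc-*ₚ : ∀ a q r → (a ·ₚ q) *ₚ r ≈ₚ a ·ₚ (q *ₚ r)
  ·ₚ-assoc-*ₚ a []      r = ≈ₚ-refl
  ·ₚ-assoc-*ₚ a (b ∷ q) r = coeffwise λ n → begin
    coeff F ((a * b ∷ a ·ₚ q) *ₚ r) n                        ≈⟨ coeff-∷* (a * b) (a ·ₚ q) r n ⟩
    (a * b) * coeff F r n + coeff F (0# ∷ (a ·ₚ q) *ₚ r) n
      ≈⟨ +-congˡ (trans (at (∷-cong refl (·ₚ-assoc-*ₚ a q r)) n) (coeff-shift-· a (q *ₚ r) n)) ⟩
    (a * b) * coeff F r n + a * coeff F (0# ∷ q *ₚ r) n      ≈⟨ trans (+-congʳ (*-assoc _ _ _)) (sym (distribˡ _ _ _)) ⟩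
    a * (b * coeff F r n + coeff F (0# ∷ q *ₚ r) n)          ≈⟨ *-congˡ (coeff-∷* b q r n) ⟨
    a * coeff F ((b ∷ q) *ₚ r) n                             ≈⟨ coeff-· a ((b ∷ q) *ₚ r) n ⟨
    coeff F (a ·ₚ ((b ∷ q) *ₚ r)) n                          ∎

  ∷0-*ₚ : ∀ p r → (0# ∷ p) *ₚ r ≈ₚ 0# ∷ (p *ₚ r)
  ∷0-*ₚ p r = coeffwise λ n → trans (coeff-∷* 0# p r n) (trans (+-congʳ (zeroˡ _)) (+-identityˡ _))

  *ₚ-assoc : ∀ p q r → (p *ₚ q) *ₚ r ≈ₚ p *ₚ (q *ₚ r)
  *ₚ-assoc []      q r = ≈ₚ-refl
  *ₚ-assoc (a ∷ p) q r = ≈ₚ-trans (*ₚ-distribʳ-+ₚ r (a ·ₚ q) (0# ∷ (p *ₚ q)))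
    (+ₚ-cong (·ₚ-assoc-*ₚ a q r) (≈ₚ-trans (∷0-*ₚ (p *ₚ q) r) (∷-cong refl (*ₚ-assoc p q r))))

  *ₚ-identityˡ : ∀ p → (1# ∷ []) *ₚ p ≈ₚ p
  *ₚ-identityˡ p = coeffwise λ n →
    trans (coeff-∷* 1# [] p n) (trans (+-cong (*-identityˡ _) (coeff-shift-[] n)) (+-identityʳ _))

  polynomialRing : CommutativeRing c ℓ
  polynomialRing = record
    { Carrier = Poly F ; _≈_ = _≈ₚ_ ; _+_ = _+ₚ_ ; _*_ = _*ₚ_ ; -_ = -ₚ_ ; 0# = [] ; 1# = 1# ∷ []
    ; isCommutativeRing = record
      { isRing = record
        { +-isAbelianGroup = record
          { isGroup = record
            { isMonoid = record
              { isSemigroup = record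
                { isMagma = record
                  { isEquivalence = record { refl = ≈ₚ-refl ; sym = ≈ₚ-sym ; trans = ≈ₚ-trans }
                  ; ∙-cong = +ₚ-cong }
                ; assoc = +ₚ-assoc }
              ; identity = (λ _ → ≈ₚ-refl) , +ₚ-identityʳ }
            ; inverse = -ₚ-inverseˡ , -ₚ-inverseʳ
            ; ⁻¹-cong = -ₚ-cong }
          ; comm = +ₚ-comm }
        ; *-cong = *ₚ-cong
        ; *-assoc = *ₚ-assoc
        ; *-identity = *ₚ-identityˡ , λ p → ≈ₚ-trans (*ₚ-comm p _) (*ₚ-identityˡ p)
        ; distrib = *ₚ-distribˡ-+ₚ , *ₚ-distribʳ-+ₚ }
      ; *-comm = *ₚ-comm } }

  module ≈ₚ-Reasoning = Relation.Binary.Reasoning.Setoid (CommutativeRing.setoid polynomialRing)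

  xₚ : Poly F
  xₚ = xP F

  xₚ-*ₚ : ∀ p → xₚ *ₚ p ≈ₚ 0# ∷ p
  xₚ-*ₚ p = ≈ₚ-trans (∷0-*ₚ (1# ∷ []) p) (∷-cong refl (*ₚ-identityˡ p))

  const-*ₚ : ∀ a p → (a ∷ []) *ₚ p ≈ₚ a ·ₚ p
  const-*ₚ a p = coeffwise λ n →
    trans (coeff-∷* a [] p n) (trans (+-cong (sym (coeff-· a p n)) (coeff-shift-[] n)) (+-identityʳ _))

  ∷-+ₚ-xₚ : ∀ a p → a ∷ p ≈ₚ (a ∷ []) +ₚ xₚ *ₚ p
  ∷-+ₚ-xₚ a p = ≈ₚ-sym (≈ₚ-trans (+ₚ-congˡ (a ∷ []) (xₚ-*ₚ p)) (∷-cong (+-identityʳ a) ≈ₚ-refl))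

module Degrees {c ℓ : Level} (F : FiniteField c ℓ) where
  open FiniteField F
  open Polynomials F
  open import Algebra.Properties.Ring ring using (-0#≈0#; -‿involutive)
  open import Data.Nat as ℕ using (_≤_; _<_; z≤n; s≤s)
  open import Data.Nat.Properties
    using (≤-refl; ≤-total; ≤-trans; <⇒≤; ≤-pred; m≤n⇒m<n∨m≡n; m≤m+n; m≤n+m; n≤1+n; ≮⇒≥; _<?_)
  open import Data.List using (length)
  open import Data.Sum using (inj₁; inj₂)
  open import Data.Product using (_×_)
  import Relation.Binary.PropositionalEquality as ≡
  open IntegerCoefficientSolver polynomialRing using (solve; _:=_; _:+_; _:*_; _:-_; :-_; con)
  module ≈-Reasoning = Relation.Binary.Reasoning.Setoid setoid

  record DegreeBelow (p : Poly F) (n : ℕ) : Set ℓ where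
    constructor degreeBelow
    field vanishes : ∀ j → n ≤ j → coeff F p j ≈ 0#
  open DegreeBelow public

  record Degree (p : Poly F) (n : ℕ) : Set ℓ where
    constructor degree
    field
      leading≉0 : ¬ coeff F p n ≈ 0#
      below     : DegreeBelow p (suc n)
  open Degree public

  degreeBelow-length : ∀ p → DegreeBelow p (length p)
  degreeBelow-length p = degreeBelow (vanish p)
    where
    vanish : ∀ p j → length p ≤ j → coeff F p j ≈ 0#
    vanish []      j       _         = refl
    vanish (a ∷ p) (suc j) (s≤s len≤j) = vanish p j len≤j

  degreeBelow-0 : ∀ {p} → DegreeBelow p 0 → p ≈ₚ []
  degreeBelow-0 p<0 = coeffwise λ n → vanishes p<0 n z≤n

  degreeBelow-1 : ∀ {p} → DegreeBelow p 1 → p ≈ₚ coeff F p 0 ∷ []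
  degreeBelow-1 {p} p<1 = coeffwise λ where
    zero    → refl
    (suc j) → vanishes p<1 (suc j) (s≤s z≤n)

  ≈ₚ[]⇒degreeBelow : ∀ {p n} → p ≈ₚ [] → DegreeBelow p n
  ≈ₚ[]⇒degreeBelow p≈0 = degreeBelow λ j _ → at p≈0 j

  degreeBelow-mono : ∀ {p m n} → m ≤ n → DegreeBelow p m → DegreeBelow p n
  degreeBelow-mono m≤n p<m = degreeBelow λ j n≤j → vanishes p<m j (≤-trans m≤n n≤j)

  degreeBelow-cong : ∀ {p q n} → p ≈ₚ q → DegreeBelow p n → DegreeBelow q n
  degreeBelow-cong p≈q p<n = degreeBelow λ j n≤j → trans (sym (at p≈q j)) (vanishes p<n j n≤j)

  degree-cong : ∀ {p q n} → p ≈ₚ q → Degree p n → Degree q n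
  degree-cong p≈q (degree lc≉0 p<n) = degree (λ lc≈0 → lc≉0 (trans (at p≈q _) lc≈0)) (degreeBelow-cong p≈q p<n)

  coeff≉0⇒< : ∀ {p d n} → ¬ coeff F p d ≈ 0# → DegreeBelow p n → d < n
  coeff≉0⇒< {d = d} {n} p_d≉0 p<n with d <? n
  ... | yes d<n = d<n
  ... | no  d≮n = ⊥-elim (p_d≉0 (vanishes p<n d (≮⇒≥ d≮n)))

  degreeBelow-step : ∀ {p n} → DegreeBelow p (suc n) → coeff F p n ≈ 0# → DegreeBelow p n
  degreeBelow-step {p} {n} p<1+n p_n≈0 = degreeBelow vanish
    where
    vanish : ∀ j → n ≤ j → coeff F p j ≈ 0#
    vanish j n≤j with m≤n⇒m<n∨m≡n n≤j
    ... | inj₁ n<j  = vanishes p<1+n j n<j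
    ... | inj₂ ≡.refl = p_n≈0

  degree-exists : ∀ {p} → ¬ p ≈ₚ [] → DoubleNegation (∃ (Degree p))
  degree-exists {p} p≉0 = search (length p) (degreeBelow-length p)
    where
    search : ∀ n → DegreeBelow p n → DoubleNegation (∃ (Degree p))
    search zero    p<0   = ⊥-elim (p≉0 (degreeBelow-0 p<0))
    search (suc n) p<1+n = do
      no p_n≉0 ← decide (coeff F p n ≈ 0#)
        where yes p_n≈0 → search n (degreeBelow-step p<1+n p_n≈0)
      return (n , degree p_n≉0 p<1+n)

  x≉0∧y≉0⇒x*y≉0 : ∀ {x y} → ¬ x ≈ 0# → ¬ y ≈ 0# → ¬ x * y ≈ 0#
  x≉0∧y≉0⇒x*y≉0 {x} {y} x≉0 y≉0 xy≈0 with inverse x x≉0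
  ... | x⁻¹ , x*x⁻¹≈1 = y≉0 (begin
    y              ≈⟨ *-identityˡ y ⟨
    1# * y         ≈⟨ *-congʳ (trans (sym x*x⁻¹≈1) (*-comm x x⁻¹)) ⟩
    (x⁻¹ * x) * y  ≈⟨ *-assoc x⁻¹ x y ⟩
    x⁻¹ * (x * y)  ≈⟨ *-congˡ xy≈0 ⟩
    x⁻¹ * 0#       ≈⟨ zeroʳ x⁻¹ ⟩
    0#             ∎)
    where open ≈-Reasoning

  *ₚ-degreeBelow : ∀ p q m n → DegreeBelow p (suc m) → DegreeBelow q (suc n) →
    DegreeBelow (p *ₚ q) (suc (m ℕ.+ n)) × coeff F (p *ₚ q) (m ℕ.+ n) ≈ coeff F p m * coeff F q n
  *ₚ-degreeBelow []      q m       n p<m q<n = degreeBelow (λ _ _ → refl) , sym (zeroˡ _)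
  *ₚ-degreeBelow (a ∷ p) q zero    n p<1 q<n = degreeBelow vanish , coeff-a·q n
    where
    open ≈-Reasoning
    coeff-a·q : ∀ j → coeff F ((a ∷ p) *ₚ q) j ≈ a * coeff F q j
    coeff-a·q j = begin
      coeff F ((a ∷ p) *ₚ q) j                    ≈⟨ coeff-∷* a p q j ⟩
      a * coeff F q j + coeff F (0# ∷ p *ₚ q) j   ≈⟨ +-congˡ (at (∷0-≈ₚ[] (p≈[]⇒p*ₚq≈[] q (degreeBelow-0 p<0))) j) ⟩
      a * coeff F q j + 0#                        ≈⟨ +-identityʳ _ ⟩
      a * coeff F q j                             ∎
      where
      p<0 : DegreeBelow p 0
      p<0 = degreeBelow λ j _ → vanishes p<1 (suc j) (s≤s z≤n)
    vanish : ∀ j → suc n ≤ j → coeff F ((a ∷ p) *ₚ q) j ≈ 0#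
    vanish j n<j = trans (coeff-a·q j) (trans (*-congˡ (vanishes q<n j n<j)) (zeroʳ a))
  *ₚ-degreeBelow (a ∷ p) q (suc m) n p<m q<n = degreeBelow vanish , top
    where
    open ≈-Reasoning
    p′<m : DegreeBelow p (suc m)
    p′<m = degreeBelow λ j m<j → vanishes p<m (suc j) (s≤s m<j)
    ih : DegreeBelow (p *ₚ q) (suc (m ℕ.+ n)) × coeff F (p *ₚ q) (m ℕ.+ n) ≈ coeff F p m * coeff F q n
    ih = *ₚ-degreeBelow p q m n p′<m q<n
    a*q_j≈0 : ∀ j → suc n ≤ j → a * coeff F q j ≈ 0#
    a*q_j≈0 j n<j = trans (*-congˡ (vanishes q<n j n<j)) (zeroʳ a)
    vanish : ∀ j → suc (suc m ℕ.+ n) ≤ j → coeff F ((a ∷ p) *ₚ q) j ≈ 0#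
    vanish (suc j) (s≤s m+n<j) = begin
      coeff F ((a ∷ p) *ₚ q) (suc j)         ≈⟨ coeff-∷* a p q (suc j) ⟩
      a * coeff F q (suc j) + coeff F (p *ₚ q) j
        ≈⟨ +-cong (a*q_j≈0 (suc j) (s≤s (≤-trans (m≤n+m n m) (≤-trans (n≤1+n _) m+n<j))))
                  (vanishes (proj₁ ih) j m+n<j) ⟩
      0# + 0#                                ≈⟨ +-identityʳ 0# ⟩
      0#                                     ∎
    top : coeff F ((a ∷ p) *ₚ q) (suc (m ℕ.+ n)) ≈ coeff F p m * coeff F q n
    top = begin
      coeff F ((a ∷ p) *ₚ q) (suc (m ℕ.+ n))                 ≈⟨ coeff-∷* a p q (suc (m ℕ.+ n)) ⟩
      a * coeff F q (suc (m ℕ.+ n)) + coeff F (p *ₚ q) (m ℕ.+ n) ≈⟨ +-congʳ (a*q_j≈0 (suc (m ℕ.+ n)) (s≤s (m≤n+m n m))) ⟩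
      0# + coeff F (p *ₚ q) (m ℕ.+ n)                        ≈⟨ +-identityˡ _ ⟩
      coeff F (p *ₚ q) (m ℕ.+ n)                             ≈⟨ proj₂ ih ⟩
      coeff F p m * coeff F q n                            ∎

  degree-*ₚ : ∀ {p q m n} → Degree p m → Degree q n → Degree (p *ₚ q) (m ℕ.+ n)
  degree-*ₚ {p} {q} {m} {n} (degree p_m≉0 p<m) (degree q_n≉0 q<n)
    with *ₚ-degreeBelow p q m n p<m q<n
  ... | pq<m+n , top = degree (λ pq≈0 → x≉0∧y≉0⇒x*y≉0 p_m≉0 q_n≉0 (trans (sym top) pq≈0)) pq<m+n

  *ₚ-noZeroDivisors : ∀ {p q} → p *ₚ q ≈ₚ [] → ¬ p ≈ₚ [] → ¬ q ≈ₚ [] → ⊥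
  *ₚ-noZeroDivisors pq≈0 p≉0 q≉0 =
    degree-exists p≉0 λ (m , p°) → degree-exists q≉0 λ (n , q°) →
    leading≉0 (degree-*ₚ p° q°) (at pq≈0 (m ℕ.+ n))

  record Division (p d : Poly F) (D : ℕ) : Set (c ⊔ ℓ) where
    constructor division
    field
      quotient remainder : Poly F
      p≈qd+r      : p ≈ₚ quotient *ₚ d +ₚ remainder
      remainder<D : DegreeBelow remainder D

  -- Dividing a ∷ p = a + x p reduces to dividing p: if p = q d + r, then
  -- a ∷ p = (k ∷ q) d + (a ∷ r − k d), and k is chosen to kill the coefficient of x^D.
  divide : ∀ {d D} → Degree d D → ∀ p → Division p d D
  divide d° []      = division [] [] ≈ₚ-refl (degreeBelow λ _ _ → refl)
  divide {d} {D} d° (a ∷ p) with divide d° p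
  ... | division q r p≈qd+r r<D = division (k ∷ q) (s +ₚ -ₚ (k ·ₚ d)) identity (degreeBelow vanish)
    where
    s : Poly F
    s = a ∷ r
    lc⁻¹ k : Carrier
    lc⁻¹ = proj₁ (inverse (coeff F d D) (leading≉0 d°))
    k = coeff F s D * lc⁻¹

    s-vanishes : ∀ j → D < j → coeff F s j ≈ 0#
    s-vanishes (suc j) (s≤s D≤j) = vanishes r<D j D≤j

    vanish : ∀ j → D ≤ j → coeff F (s +ₚ -ₚ (k ·ₚ d)) j ≈ 0#
    vanish j D≤j with m≤n⇒m<n∨m≡n D≤j
    ... | inj₁ D<j = begin
      coeff F (s +ₚ -ₚ (k ·ₚ d)) j     ≈⟨ trans (coeff-sub s (k ·ₚ d) j) (+-congˡ (-‿cong (coeff-· k d j))) ⟩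
      coeff F s j - k * coeff F d j    ≈⟨ +-cong (s-vanishes j D<j) (-‿cong (*-congˡ (vanishes (below d°) j D<j))) ⟩
      0# - k * 0#                      ≈⟨ +-congˡ (trans (-‿cong (zeroʳ k)) -0#≈0#) ⟩
      0# + 0#                          ≈⟨ +-identityʳ 0# ⟩
      0#                               ∎
      where open ≈-Reasoning
    ... | inj₂ ≡.refl = begin
      coeff F (s +ₚ -ₚ (k ·ₚ d)) D             ≈⟨ trans (coeff-sub s (k ·ₚ d) D) (+-congˡ (-‿cong (coeff-· k d D))) ⟩
      sᴰ - (sᴰ * lc⁻¹) * coeff F d D         ≈⟨ +-congˡ (-‿cong (trans (*-assoc _ _ _) (*-congˡ (*-comm _ _)))) ⟩
      sᴰ - sᴰ * (coeff F d D * lc⁻¹)         ≈⟨ +-congˡ (-‿cong (*-congˡ (proj₂ (inverse (coeff F d D) (leading≉0 d°))))) ⟩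
      sᴰ - sᴰ * 1#                           ≈⟨ +-congˡ (-‿cong (*-identityʳ sᴰ)) ⟩
      sᴰ - sᴰ                                ≈⟨ -‿inverseʳ sᴰ ⟩
      0#                                       ∎
      where
      open ≈-Reasoning
      sᴰ : Carrier
      sᴰ = coeff F s D

    identity : a ∷ p ≈ₚ (k ∷ q) *ₚ d +ₚ (s +ₚ -ₚ (k ·ₚ d))
    identity = begin
      a ∷ p                                             ≈⟨ ∷-+ₚ-xₚ a p ⟩
      (a ∷ []) +ₚ xₚ *ₚ p                               ≈⟨ +ₚ-congˡ (a ∷ []) (*ₚ-congʳ xₚ p≈qd+r) ⟩
      (a ∷ []) +ₚ xₚ *ₚ (q *ₚ d +ₚ r)
        ≈⟨ solve 6 (λ a x q d r kd → a :+ x :* (q :* d :+ r) := (kd :+ x :* (q :* d)) :+ ((a :+ x :* r) :- kd))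
                 ≈ₚ-refl (a ∷ []) xₚ q d r (k ·ₚ d) ⟩
      (k ·ₚ d +ₚ xₚ *ₚ (q *ₚ d)) +ₚ (((a ∷ []) +ₚ xₚ *ₚ r) +ₚ -ₚ (k ·ₚ d))
        ≈⟨ +ₚ-cong (+ₚ-congˡ (k ·ₚ d) (xₚ-*ₚ (q *ₚ d))) (+ₚ-congʳ (-ₚ (k ·ₚ d)) (≈ₚ-sym (∷-+ₚ-xₚ a r))) ⟩
      (k ∷ q) *ₚ d +ₚ (s +ₚ -ₚ (k ·ₚ d))                ∎
      where open ≈ₚ-Reasoning

  infix 4 _∣ₚ_
  _∣ₚ_ : Poly F → Poly F → Set (c ⊔ ℓ)
  d ∣ₚ p = ∃ λ e → d *ₚ e ≈ₚ p

  ∣ₚ-resp-≈ₚ : ∀ {d p q} → p ≈ₚ q → d ∣ₚ p → d ∣ₚ q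
  ∣ₚ-resp-≈ₚ p≈q (e , de≈p) = e , ≈ₚ-trans de≈p p≈q

  ∣ₚ⇒∣P : ∀ {d p} → d ∣ₚ p → _∣P_ F d p
  ∣ₚ⇒∣P (e , d*e≈p) = e , at d*e≈p

  remainder≈0⇒∣ₚ : ∀ {p d D} (div : Division p d D) → Division.remainder div ≈ₚ [] → d ∣ₚ p
  remainder≈0⇒∣ₚ {p} {d} (division q r p≈qd+r _) r≈0 = q , (begin
    d *ₚ q        ≈⟨ solve 3 (λ d q r → d :* q := (q :* d :+ r) :- r) ≈ₚ-refl d q r ⟩
    (q *ₚ d +ₚ r) +ₚ -ₚ r  ≈⟨ +ₚ-cong (≈ₚ-sym p≈qd+r) (-ₚ-cong r≈0) ⟩
    p +ₚ -ₚ []    ≈⟨ +ₚ-identityʳ p ⟩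
    p             ∎)
    where open ≈ₚ-Reasoning

  ∣ₚ-const-*ₚ : ∀ {f a p} → ¬ a ≈ 0# → f ∣ₚ (a ∷ []) *ₚ p → f ∣ₚ p
  ∣ₚ-const-*ₚ {f} {a} {p} a≉0 (k , fk≈ap) = (a⁻¹ ∷ []) *ₚ k , (begin
    f *ₚ ((a⁻¹ ∷ []) *ₚ k)           ≈⟨ solve 3 (λ f b k → f :* (b :* k) := b :* (f :* k)) ≈ₚ-refl f (a⁻¹ ∷ []) k ⟩
    (a⁻¹ ∷ []) *ₚ (f *ₚ k)           ≈⟨ *ₚ-congʳ (a⁻¹ ∷ []) fk≈ap ⟩
    (a⁻¹ ∷ []) *ₚ ((a ∷ []) *ₚ p)    ≈⟨ *ₚ-assoc (a⁻¹ ∷ []) (a ∷ []) p ⟨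
    ((a⁻¹ ∷ []) *ₚ (a ∷ [])) *ₚ p    ≈⟨ *ₚ-congˡ p (≈ₚ-trans (const-*ₚ a⁻¹ (a ∷ [])) (∷-cong a⁻¹*a≈1 ≈ₚ-refl)) ⟩
    (1# ∷ []) *ₚ p                   ≈⟨ *ₚ-identityˡ p ⟩
    p                                ∎)
    where
    open ≈ₚ-Reasoning
    a⁻¹ : Carrier
    a⁻¹ = proj₁ (inverse a a≉0)
    a⁻¹*a≈1 : a⁻¹ * a ≈ 1#
    a⁻¹*a≈1 = trans (*-comm a⁻¹ a) (proj₂ (inverse a a≉0))

  record Combination (f g e : Poly F) : Set (c ⊔ ℓ) where
    constructor combination
    field
      s t     : Poly F
      sf+tg≈e : s *ₚ f +ₚ t *ₚ g ≈ₚ e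

  Bezout : Poly F → Poly F → Set (c ⊔ ℓ)
  Bezout f g = Combination f g (1# ∷ [])

  combination-cong : ∀ {f g e e′} → e ≈ₚ e′ → Combination f g e → Combination f g e′
  combination-cong e≈e′ (combination s t sf+tg≈e) = combination s t (≈ₚ-trans sf+tg≈e e≈e′)

  combinationˡ : ∀ f g → Combination f g f
  combinationˡ f g = combination (1# ∷ []) [] (≈ₚ-trans (+ₚ-identityʳ _) (*ₚ-identityˡ f))

  combinationʳ : ∀ f g → Combination f g g
  combinationʳ f g = combination [] (1# ∷ []) (*ₚ-identityˡ g)

  combination-scale : ∀ {f g e} v → Combination f g e → Combination f g (v *ₚ e)
  combination-scale {f} {g} {e} v (combination s t sf+tg≈e) = combination (v *ₚ s) (v *ₚ t) (begin
    (v *ₚ s) *ₚ f +ₚ (v *ₚ t) *ₚ g  ≈⟨ solve 5 (λ v s t f g → (v :* s) :* f :+ (v :* t) :* g := v :* (s :* f :+ t :* g)) ≈ₚ-refl v s t f g ⟩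
    v *ₚ (s *ₚ f +ₚ t *ₚ g)         ≈⟨ *ₚ-congʳ v sf+tg≈e ⟩
    v *ₚ e                          ∎)
    where open ≈ₚ-Reasoning

  remainder-combination : ∀ {f g p e D} → Combination f g p → Combination f g e →
    (div : Division p e D) → Combination f g (Division.remainder div)
  remainder-combination {f} {g} {p} {e} (combination s t sf+tg≈p) (combination s′ t′ s′f+t′g≈e) (division q r p≈qe+r _) =
    combination (s +ₚ -ₚ (q *ₚ s′)) (t +ₚ -ₚ (q *ₚ t′)) (begin
      (s +ₚ -ₚ (q *ₚ s′)) *ₚ f +ₚ (t +ₚ -ₚ (q *ₚ t′)) *ₚ g
        ≈⟨ solve 7 (λ s t s′ t′ q f g → (s :- q :* s′) :* f :+ (t :- q :* t′) :* g
                                      := (s :* f :+ t :* g) :- q :* (s′ :* f :+ t′ :* g)) ≈ₚ-refl s t s′ t′ q f g ⟩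
      (s *ₚ f +ₚ t *ₚ g) +ₚ -ₚ (q *ₚ (s′ *ₚ f +ₚ t′ *ₚ g))
        ≈⟨ +ₚ-cong (≈ₚ-trans sf+tg≈p p≈qe+r) (-ₚ-cong (*ₚ-congʳ q s′f+t′g≈e)) ⟩
      (q *ₚ e +ₚ r) +ₚ -ₚ (q *ₚ e)
        ≈⟨ solve 3 (λ q e r → (q :* e :+ r) :- q :* e := r) ≈ₚ-refl q e r ⟩
      r ∎)
    where open ≈ₚ-Reasoning

  -- Euclid's algorithm in the form of a descent: a nonzero combination of least degree
  -- divides f and g (its remainders are combinations of smaller degree), hence is a unit.
  bezout : ∀ f g → GcdOne F f g → ¬ f ≈ₚ [] → DoubleNegation (Bezout f g)
  bezout f g gcd≈1 f≉0 = descend (length f) (combinationˡ f g) f≉0 (degreeBelow-length f)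
    where
    descend : ∀ n {e} → Combination f g e → ¬ e ≈ₚ [] → DegreeBelow e n → DoubleNegation (Bezout f g)
    descend zero    _  e≉0 e<0   = ⊥-elim (e≉0 (degreeBelow-0 e<0))
    descend (suc n) {e} e∈ e≉0 e<1+n = do
      (D , e°) ← degree-exists e≉0
      let D≤n = ≤-pred (coeff≉0⇒< (leading≉0 e°) e<1+n)
          f÷e = divide e° f
          g÷e = divide e° g
          smaller : ∀ {p} (p÷e : Division p e D) → Combination f g p → ¬ Division.remainder p÷e ≈ₚ [] → DoubleNegation (Bezout f g)
          smaller p÷e p∈ r≉0 = descend n (remainder-combination p∈ e∈ p÷e) r≉0
                                        (degreeBelow-mono D≤n (Division.remainder<D p÷e))
      yes rf≈0 ← decide (Division.remainder f÷e ≈ₚ [])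
        where no rf≉0 → smaller f÷e (combinationˡ f g) rf≉0
      yes rg≈0 ← decide (Division.remainder g÷e ≈ₚ [])
        where no rg≉0 → smaller g÷e (combinationʳ f g) rg≉0
      let (v , e*v≈1) = gcd≈1 e (∣ₚ⇒∣P {e} (remainder≈0⇒∣ₚ f÷e rf≈0)) (∣ₚ⇒∣P {e} (remainder≈0⇒∣ₚ g÷e rg≈0))
      return (combination-cong (≈ₚ-trans (*ₚ-comm v e) (coeffwise e*v≈1)) (combination-scale v e∈))

  bezout-∣ₚ : ∀ {f g y} → Bezout f g → f ∣ₚ y *ₚ g → f ∣ₚ y
  bezout-∣ₚ {f} {g} {y} (combination s t sf+tg≈1) (k , fk≈yg) = y *ₚ s +ₚ t *ₚ k , (begin
    f *ₚ (y *ₚ s +ₚ t *ₚ k)           ≈⟨ solve 5 (λ f y s t k → f :* (y :* s :+ t :* k) := y :* s :* f :+ t :* (f :* k)) ≈ₚ-refl f y s t k ⟩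
    y *ₚ s *ₚ f +ₚ t *ₚ (f *ₚ k)      ≈⟨ +ₚ-congˡ (y *ₚ s *ₚ f) (*ₚ-congʳ t fk≈yg) ⟩
    y *ₚ s *ₚ f +ₚ t *ₚ (y *ₚ g)      ≈⟨ solve 5 (λ f g y s t → y :* s :* f :+ t :* (y :* g) := y :* (s :* f :+ t :* g)) ≈ₚ-refl f g y s t ⟩
    y *ₚ (s *ₚ f +ₚ t *ₚ g)           ≈⟨ *ₚ-congʳ y sf+tg≈1 ⟩
    y *ₚ (1# ∷ [])                    ≈⟨ *ₚ-comm y _ ⟩
    (1# ∷ []) *ₚ y                    ≈⟨ *ₚ-identityˡ y ⟩
    y                                 ∎)
    where open ≈ₚ-Reasoning

  degree-xₚ : Degree xₚ 1
  degree-xₚ = degree nontrivial (degreeBelow vanish)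
    where
    vanish : ∀ j → 2 ≤ j → coeff F xₚ j ≈ 0#
    vanish (suc (suc j)) _             = refl
    vanish (suc zero)    (s≤s ())

  -ₚ-degree-dominantˡ : ∀ {p q d} → Degree p d → DegreeBelow q d → Degree (p +ₚ -ₚ q) d
  -ₚ-degree-dominantˡ {p} {q} {d} (degree p_d≉0 p<1+d) q<d = degree leading (degreeBelow vanish)
    where
    open ≈-Reasoning
    leading : ¬ coeff F (p +ₚ -ₚ q) d ≈ 0#
    leading pq_d≈0 = p_d≉0 (begin
      coeff F p d                ≈⟨ +-identityʳ _ ⟨
      coeff F p d + 0#           ≈⟨ +-congˡ (trans (-‿cong (vanishes q<d d ≤-refl)) -0#≈0#) ⟨
      coeff F p d - coeff F q d  ≈⟨ coeff-sub p q d ⟨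
      coeff F (p +ₚ -ₚ q) d      ≈⟨ pq_d≈0 ⟩
      0#                         ∎)
    vanish : ∀ j → suc d ≤ j → coeff F (p +ₚ -ₚ q) j ≈ 0#
    vanish j d<j = coeff-sub≈0 p q (vanishes p<1+d j d<j) (vanishes q<d j (<⇒≤ d<j))

  degree-neg : ∀ {p d} → Degree p d → Degree (-ₚ p) d
  degree-neg {p} {d} (degree p_d≉0 p<1+d) = degree
    (λ -p_d≈0 → p_d≉0 (trans (sym (-‿involutive _)) (trans (-‿cong (trans (sym (coeff-neg p d)) -p_d≈0)) -0#≈0#)))
    (degreeBelow λ j d<j → trans (coeff-neg p j) (trans (-‿cong (vanishes p<1+d j d<j)) -0#≈0#))

  -ₚ-degree-dominantʳ : ∀ {p q d} → DegreeBelow p d → Degree q d → Degree (p +ₚ -ₚ q) d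
  -ₚ-degree-dominantʳ {p} {q} p<d q° = degree-cong
    (solve 2 (λ p q → :- (q :- p) := p :- q) ≈ₚ-refl p q)
    (degree-neg (-ₚ-degree-dominantˡ q° p<d))

  DegLt-sub : ∀ {p q f} → DegLt F p f → DegLt F q f → DegLt F (p +ₚ -ₚ q) f
  DegLt-sub {p} {q} (d₁ , f_d₁≉0 , p-vanishes) (d₂ , f_d₂≉0 , q-vanishes) with ≤-total d₁ d₂
  ... | inj₁ d₁≤d₂ = d₂ , f_d₂≉0 , λ j d₂≤j → coeff-sub≈0 p q (p-vanishes j (≤-trans d₁≤d₂ d₂≤j)) (q-vanishes j d₂≤j)
  ... | inj₂ d₂≤d₁ = d₁ , f_d₁≉0 , λ j d₁≤j → coeff-sub≈0 p q (p-vanishes j d₁≤j) (q-vanishes j (≤-trans d₂≤d₁ d₁≤j))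

  ∣ₚ∧DegLt⇒≈[] : ∀ {f w} → ¬ f ≈ₚ [] → f ∣ₚ w → DegLt F w f → DoubleNegation (w ≈ₚ [])
  ∣ₚ∧DegLt⇒≈[] {f} {w} f≉0 (k , fk≈w) (d , f_d≉0 , w-vanishes) = do
    no k≉0 ← decide (k ≈ₚ [])
      where yes k≈0 → return (≈ₚ-trans (≈ₚ-sym fk≈w) (≈ₚ-trans (*ₚ-congʳ f k≈0) (*ₚ-zeroʳ f)))
    (D , f°) ← degree-exists f≉0
    (e , k°) ← degree-exists k≉0
    let d≤D = ≤-pred (coeff≉0⇒< f_d≉0 (below f°))
    ⊥-elim (leading≉0 (degree-*ₚ f° k°) (trans (at fk≈w (D ℕ.+ e)) (w-vanishes (D ℕ.+ e) (≤-trans d≤D (m≤m+n D e)))))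

module CoordinateRing {c ℓ : Level} (F : FiniteField c ℓ) (P : Poly F) where
  open FiniteField F using (1#)
  open Polynomials F
  open IntegerCoefficientSolver polynomialRing using (solve; _:=_; _:+_; _:*_; _:-_; :-_; con)
  open import Data.Integer using (+_)
  open Coord F P public using (Elt; 0R) renaming (_+R_ to infixl 6 _+ᶜ_; _*R_ to infixl 7 _*ᶜ_)

  infix 8 -ᶜ_
  infix 4 _≈ᶜ_

  record _≈ᶜ_ (z w : Elt) : Set ℓ where
    constructor _,≈_
    field
      fst≈ : proj₁ z ≈ₚ proj₁ w
      snd≈ : proj₂ z ≈ₚ proj₂ w
  open _≈ᶜ_ public

  -ᶜ_ : Elt → Elt
  -ᶜ (a , b) = -ₚ a , -ₚ b

  1R : Elt
  1R = 1# ∷ [] , []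

  ≈R⇒≈ᶜ : ∀ z w → Coord._≈R_ F P z w → z ≈ᶜ w
  ≈R⇒≈ᶜ _ _ (a≋a′ , b≋b′) = coeffwise a≋a′ ,≈ coeffwise b≋b′

  ≈ᶜ⇒≈R : ∀ {z w} → z ≈ᶜ w → Coord._≈R_ F P z w
  ≈ᶜ⇒≈R (a≈a′ ,≈ b≈b′) = at a≈a′ , at b≈b′

  coordinateRing : CommutativeRing c ℓ
  coordinateRing = record
    { Carrier = Elt ; _≈_ = _≈ᶜ_ ; _+_ = _+ᶜ_ ; _*_ = _*ᶜ_ ; -_ = -ᶜ_ ; 0# = 0R ; 1# = 1R
    ; isCommutativeRing = record
      { isRing = record
        { +-isAbelianGroup = record
          { isGroup = record
            { isMonoid = record
              { isSemigroup = record
                { isMagma = record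
                  { isEquivalence = record
                    { refl  = ≈ₚ-refl ,≈ ≈ₚ-refl
                    ; sym   = λ (a≈ ,≈ b≈) → ≈ₚ-sym a≈ ,≈ ≈ₚ-sym b≈
                    ; trans = λ (a≈ ,≈ b≈) (a≈′ ,≈ b≈′) → ≈ₚ-trans a≈ a≈′ ,≈ ≈ₚ-trans b≈ b≈′ }
                  ; ∙-cong = λ (a≈ ,≈ b≈) (a≈′ ,≈ b≈′) → +ₚ-cong a≈ a≈′ ,≈ +ₚ-cong b≈ b≈′ }
                ; assoc = λ (a , b) (a′ , b′) (a″ , b″) → +ₚ-assoc a a′ a″ ,≈ +ₚ-assoc b b′ b″ }
              ; identity = (λ _ → ≈ₚ-refl ,≈ ≈ₚ-refl) , (λ (a , b) → +ₚ-identityʳ a ,≈ +ₚ-identityʳ b) }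
            ; inverse = (λ (a , b) → -ₚ-inverseˡ a ,≈ -ₚ-inverseˡ b) , (λ (a , b) → -ₚ-inverseʳ a ,≈ -ₚ-inverseʳ b)
            ; ⁻¹-cong = λ (a≈ ,≈ b≈) → -ₚ-cong a≈ ,≈ -ₚ-cong b≈ }
          ; comm = λ (a , b) (a′ , b′) → +ₚ-comm a a′ ,≈ +ₚ-comm b b′ }
        ; *-cong = λ (a≈ ,≈ b≈) (a≈′ ,≈ b≈′) →
            +ₚ-cong (*ₚ-cong a≈ a≈′) (*ₚ-congʳ P (*ₚ-cong b≈ b≈′)) ,≈ +ₚ-cong (*ₚ-cong a≈ b≈′) (*ₚ-cong b≈ a≈′)
        ; *-assoc = λ (a , b) (c , d) (e , f) →
            solve 7 (λ P a b c d e f → (a :* c :+ P :* (b :* d)) :* e :+ P :* ((a :* d :+ b :* c) :* f)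
                                    := a :* (c :* e :+ P :* (d :* f)) :+ P :* (b :* (c :* f :+ d :* e)))
                  ≈ₚ-refl P a b c d e f
            ,≈ solve 7 (λ P a b c d e f → (a :* c :+ P :* (b :* d)) :* f :+ (a :* d :+ b :* c) :* e
                                       := a :* (c :* f :+ d :* e) :+ b :* (c :* e :+ P :* (d :* f)))
                     ≈ₚ-refl P a b c d e f
        ; *-identity =
            (λ (a , b) → solve 3 (λ P a b → con (+ 1) :* a :+ P :* (con (+ 0) :* b) := a) ≈ₚ-refl P a b
                      ,≈ solve 2 (λ a b → con (+ 1) :* b :+ con (+ 0) :* a := b) ≈ₚ-refl a b)
          , (λ (a , b) → solve 3 (λ P a b → a :* con (+ 1) :+ P :* (b :* con (+ 0)) := a) ≈ₚ-refl P a b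
                      ,≈ solve 2 (λ a b → a :* con (+ 0) :+ b :* con (+ 1) := b) ≈ₚ-refl a b)
        ; distrib =
            (λ (a , b) (c , d) (e , f) →
               solve 7 (λ P a b c d e f → a :* (c :+ e) :+ P :* (b :* (d :+ f))
                                       := (a :* c :+ P :* (b :* d)) :+ (a :* e :+ P :* (b :* f))) ≈ₚ-refl P a b c d e f
            ,≈ solve 6 (λ a b c d e f → a :* (d :+ f) :+ b :* (c :+ e)
                                     := (a :* d :+ b :* c) :+ (a :* f :+ b :* e)) ≈ₚ-refl a b c d e f)
          , (λ (a , b) (c , d) (e , f) →
               solve 7 (λ P a b c d e f → (c :+ e) :* a :+ P :* ((d :+ f) :* b)
                                       := (c :* a :+ P :* (d :* b)) :+ (e :* a :+ P :* (f :* b))) ≈ₚ-refl P a b c d e f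
            ,≈ solve 6 (λ a b c d e f → (c :+ e) :* b :+ (d :+ f) :* a
                                     := (c :* b :+ d :* a) :+ (e :* b :+ f :* a)) ≈ₚ-refl a b c d e f) }
      ; *-comm = λ (a , b) (c , d) →
          solve 5 (λ P a b c d → a :* c :+ P :* (b :* d) := c :* a :+ P :* (d :* b)) ≈ₚ-refl P a b c d
          ,≈ solve 4 (λ a b c d → a :* d :+ b :* c := c :* b :+ d :* a) ≈ₚ-refl a b c d } }

  *ᶜ-congˡ : ∀ z {u v} → u ≈ᶜ v → z *ᶜ u ≈ᶜ z *ᶜ v
  *ᶜ-congˡ z = CommutativeRing.*-congˡ coordinateRing {z}

  *ᶜ-congʳ : ∀ z {u v} → u ≈ᶜ v → u *ᶜ z ≈ᶜ v *ᶜ z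
  *ᶜ-congʳ z = CommutativeRing.*-congʳ coordinateRing {z}

  norm : Elt → Poly F
  norm (a , b) = a *ₚ a +ₚ -ₚ (P *ₚ (b *ₚ b))

  norm-cong : ∀ {z w} → z ≈ᶜ w → norm z ≈ₚ norm w
  norm-cong (a≈ ,≈ b≈) = +ₚ-cong (*ₚ-cong a≈ a≈) (-ₚ-cong (*ₚ-congʳ P (*ₚ-cong b≈ b≈)))

  norm-*ᶜ : ∀ z w → norm (z *ᶜ w) ≈ₚ norm z *ₚ norm w
  norm-*ᶜ (a , b) (c , d) =
    solve 5 (λ P a b c d → (a :* c :+ P :* (b :* d)) :* (a :* c :+ P :* (b :* d)) :- P :* ((a :* d :+ b :* c) :* (a :* d :+ b :* c))
                         := (a :* a :- P :* (b :* b)) :* (c :* c :- P :* (d :* d))) ≈ₚ-refl P a b c d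

  norm-0R : norm 0R ≈ₚ []
  norm-0R = solve 1 (λ P → con (+ 0) :* con (+ 0) :- P :* (con (+ 0) :* con (+ 0)) := con (+ 0)) ≈ₚ-refl P

  norm-1R : norm 1R ≈ₚ 1# ∷ []
  norm-1R = solve 1 (λ P → con (+ 1) :* con (+ 1) :- P :* (con (+ 0) :* con (+ 0)) := con (+ 1)) ≈ₚ-refl P

module OddDegreeCoordinateRing {c ℓ : Level} (F : FiniteField c ℓ) (P : Poly F) (k : ℕ)
                               (P° : Degrees.Degree F P (suc (k ℕ.+ k))) where
  open FiniteField F using (_≈_; 0#; 1#)
  open Polynomials F
  open Degrees F
  open CoordinateRing F P
  open import Data.Nat using (_≤_; z≤n; s≤s)
  open import Data.Nat.Properties using (≤-trans; <⇒≤; m≤m+n; <-cmp; suc-injective; +-suc)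
  open import Data.Nat.Tactic.RingSolver using (solve-∀)
  open import Data.Product using (_×_)
  open import Relation.Binary.Definitions using (tri<; tri≈; tri>)
  open import Relation.Binary.PropositionalEquality as ≡ using (_≡_; _≢_)

  even≢odd : ∀ m n → m ℕ.+ m ≢ suc (n ℕ.+ n)
  even≢odd zero    n       ()
  even≢odd (suc m) zero    eq with ≡.trans (≡.sym (+-suc m m)) (suc-injective eq)
  ... | ()
  even≢odd (suc m) (suc n) eq = even≢odd m n
    (suc-injective (≡.trans (≡.sym (+-suc m m)) (≡.trans (suc-injective eq) (≡.cong suc (+-suc n n)))))

  degree-P*b² : ∀ {b n} → Degree b n → Degree (P *ₚ (b *ₚ b)) (suc ((k ℕ.+ n) ℕ.+ (k ℕ.+ n)))
  degree-P*b² {n = n} b° = ≡.subst (Degree _) (odd-sum k n) (degree-*ₚ P° (degree-*ₚ b° b°))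
    where
    odd-sum : ∀ k n → suc (k ℕ.+ k) ℕ.+ (n ℕ.+ n) ≡ suc ((k ℕ.+ n) ℕ.+ (k ℕ.+ n))
    odd-sum = solve-∀

  -- The degrees of a² (even) and P b² (odd) never cancel in the norm a² − P b².
  data NormDegree (a b : Poly F) : Set (c ⊔ ℓ) where
    norm-of-zero : a ≈ₚ [] → b ≈ₚ [] → NormDegree a b
    norm-degree  : ∀ d → Degree (norm (a , b)) d → (¬ b ≈ₚ [] → 1 ≤ d) → DegreeBelow a (suc d) → NormDegree a b

  normDegree : ∀ a b → DoubleNegation (NormDegree a b)
  normDegree a b = do
    a≈0? ← decide (a ≈ₚ [])
    b≈0? ← decide (b ≈ₚ [])
    cases a≈0? b≈0?
    where
    P*b²≈0 : b ≈ₚ [] → P *ₚ (b *ₚ b) ≈ₚ []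
    P*b²≈0 b≈0 = ≈ₚ-trans (*ₚ-congʳ P (p≈[]⇒p*ₚq≈[] b b≈0)) (*ₚ-zeroʳ P)
    cases : Dec (a ≈ₚ []) → Dec (b ≈ₚ []) → DoubleNegation (NormDegree a b)
    cases (yes a≈0) (yes b≈0) = return (norm-of-zero a≈0 b≈0)
    cases (no a≉0)  (yes b≈0) = do
      (m , a°) ← degree-exists a≉0
      return (norm-degree (m ℕ.+ m)
        (degree-cong (≈ₚ-sym (≈ₚ-trans (+ₚ-congˡ (a *ₚ a) (-ₚ-cong (P*b²≈0 b≈0))) (+ₚ-identityʳ _))) (degree-*ₚ a° a°))
        (λ b≉0 → ⊥-elim (b≉0 b≈0))
        (degreeBelow-mono (s≤s (m≤m+n m m)) (below a°)))
    cases (yes a≈0) (no b≉0)  = do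
      (n , b°) ← degree-exists b≉0
      return (norm-degree _
        (-ₚ-degree-dominantʳ (≈ₚ[]⇒degreeBelow (p≈[]⇒p*ₚq≈[] a a≈0)) (degree-P*b² b°))
        (λ _ → s≤s z≤n)
        (≈ₚ[]⇒degreeBelow a≈0))
    cases (no a≉0)  (no b≉0)  = do
      (m , a°) ← degree-exists a≉0
      (n , b°) ← degree-exists b≉0
      return (compare {e = k ℕ.+ n} (degree-*ₚ a° a°) (degree-P*b² b°) (below a°))
      where
      compare : ∀ {m e} → Degree (a *ₚ a) (m ℕ.+ m) → Degree (P *ₚ (b *ₚ b)) (suc (e ℕ.+ e)) →
                DegreeBelow a (suc m) → NormDegree a b
      compare {m} {e} a²° Pb²° a<1+m with <-cmp (m ℕ.+ m) (suc (e ℕ.+ e))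
      ... | tri< 2m<odd _ _ = norm-degree _ (-ₚ-degree-dominantʳ (degreeBelow-mono 2m<odd (below a²°)) Pb²°)
                                (λ _ → s≤s z≤n) (degreeBelow-mono (s≤s (≤-trans (m≤m+n m m) (<⇒≤ 2m<odd))) a<1+m)
      ... | tri≈ _ 2m≡odd _ = ⊥-elim (even≢odd m e 2m≡odd)
      ... | tri> _ _ odd<2m = norm-degree _ (-ₚ-degree-dominantˡ a²° (degreeBelow-mono odd<2m (below Pb²°)))
                                (λ _ → ≤-trans (s≤s z≤n) odd<2m) (degreeBelow-mono (s≤s (m≤m+n m m)) a<1+m)

  private
    module CR = CommutativeRing coordinateRing
  open IntegerCoefficientSolver coordinateRing using (solve; _:=_; _:+_; _:*_; _:-_)

  norm≈0⇒≈0 : ∀ {z} → norm z ≈ₚ [] → DoubleNegation (z ≈ᶜ 0R)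
  norm≈0⇒≈0 {a , b} N≈0 = do
    norm-degree d N° _ _ ← normDegree a b
      where norm-of-zero a≈0 b≈0 → return (a≈0 ,≈ b≈0)
    ⊥-elim (leading≉0 N° (at N≈0 d))

  ≉0⇒norm≉0 : ∀ {z} → ¬ z ≈ᶜ 0R → ¬ norm z ≈ₚ []
  ≉0⇒norm≉0 z≉0 N≈0 = norm≈0⇒≈0 N≈0 z≉0

  *ᶜ-noZeroDivisors : ∀ {z w} → ¬ z ≈ᶜ 0R → z *ᶜ w ≈ᶜ 0R → DoubleNegation (w ≈ᶜ 0R)
  *ᶜ-noZeroDivisors {z} {w} z≉0 zw≈0 = do
    yes Nw≈0 ← decide (norm w ≈ₚ [])
      where no Nw≉0 → ⊥-elim (*ₚ-noZeroDivisors Nz*Nw≈0 (≉0⇒norm≉0 z≉0) Nw≉0)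
    norm≈0⇒≈0 Nw≈0
    where
    Nz*Nw≈0 : norm z *ₚ norm w ≈ₚ []
    Nz*Nw≈0 = ≈ₚ-trans (≈ₚ-sym (norm-*ᶜ z w)) (≈ₚ-trans (norm-cong zw≈0) norm-0R)

  *ᶜ-≉0 : ∀ {z w} → ¬ z ≈ᶜ 0R → ¬ w ≈ᶜ 0R → ¬ z *ᶜ w ≈ᶜ 0R
  *ᶜ-≉0 z≉0 w≉0 zw≈0 = *ᶜ-noZeroDivisors z≉0 zw≈0 w≉0

  *ᶜ-cancelˡ : ∀ {z u v} → ¬ z ≈ᶜ 0R → z *ᶜ u ≈ᶜ z *ᶜ v → DoubleNegation (u ≈ᶜ v)
  *ᶜ-cancelˡ {z} {u} {v} z≉0 zu≈zv = do
    u-v≈0 ← *ᶜ-noZeroDivisors z≉0 (begin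
      z *ᶜ (u +ᶜ -ᶜ v)        ≈⟨ solve 3 (λ z u v → z :* (u :- v) := z :* u :- z :* v) CR.refl z u v ⟩
      z *ᶜ u +ᶜ -ᶜ (z *ᶜ v)   ≈⟨ CR.+-congʳ zu≈zv ⟩
      z *ᶜ v +ᶜ -ᶜ (z *ᶜ v)   ≈⟨ CR.-‿inverseʳ (z *ᶜ v) ⟩
      0R                      ∎)
    return (begin
      u                  ≈⟨ solve 2 (λ u v → u := (u :- v) :+ v) CR.refl u v ⟩
      (u +ᶜ -ᶜ v) +ᶜ v   ≈⟨ CR.+-congʳ u-v≈0 ⟩
      0R +ᶜ v            ≈⟨ CR.+-identityˡ v ⟩
      v                  ∎)
    where open Relation.Binary.Reasoning.Setoid CR.setoid

  unit⇒constant : ∀ u v → u *ᶜ v ≈ᶜ 1R → DoubleNegation (∃ λ a → ¬ a ≈ 0# × u ≈ᶜ (a ∷ [] , []))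
  unit⇒constant (a , b) v uv≈1 = do
    (e , Nv°) ← degree-exists Nv≉0
    norm-degree d Nu° b≉0⇒1≤d a<1+d ← normDegree a b
      where norm-of-zero a≈0 b≈0 → ⊥-elim (Nu≉0 (≈ₚ-trans (norm-cong (a≈0 ,≈ b≈0)) norm-0R))
    constant d e Nu° Nv° b≉0⇒1≤d a<1+d
    where
    Nu*Nv≈1 : norm (a , b) *ₚ norm v ≈ₚ 1# ∷ []
    Nu*Nv≈1 = ≈ₚ-trans (≈ₚ-sym (norm-*ᶜ (a , b) v)) (≈ₚ-trans (norm-cong uv≈1) norm-1R)
    1≉0 : ¬ (1# ∷ []) ≈ₚ []
    1≉0 1≈0 = FiniteField.nontrivial F (at 1≈0 0)
    Nu≉0 : ¬ norm (a , b) ≈ₚ []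
    Nu≉0 Nu≈0 = 1≉0 (≈ₚ-trans (≈ₚ-sym Nu*Nv≈1) (p≈[]⇒p*ₚq≈[] (norm v) Nu≈0))
    Nv≉0 : ¬ norm v ≈ₚ []
    Nv≉0 Nv≈0 = 1≉0 (≈ₚ-trans (≈ₚ-sym Nu*Nv≈1) (≈ₚ-trans (*ₚ-congʳ (norm (a , b)) Nv≈0) (*ₚ-zeroʳ (norm (a , b)))))
    constant : ∀ d e → Degree (norm (a , b)) d → Degree (norm v) e → (¬ b ≈ₚ [] → 1 ≤ d) → DegreeBelow a (suc d) →
               DoubleNegation (∃ λ a₀ → ¬ a₀ ≈ 0# × (a , b) ≈ᶜ (a₀ ∷ [] , []))
    constant (suc d) e Nu° Nv° _ _ = ⊥-elim (leading≉0 (degree-*ₚ Nu° Nv°) (at Nu*Nv≈1 (suc d ℕ.+ e)))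
    constant zero    e Nu° Nv° b≉0⇒1≤0 a<1 = do
      yes b≈0 ← decide (b ≈ₚ [])
        where no b≉0 → ⊥-elim (1≰0 (b≉0⇒1≤0 b≉0))
      no a₀≉0 ← decide (coeff F a 0 ≈ 0#)
        where yes a₀≈0 → ⊥-elim (Nu≉0 (≈ₚ-trans (norm-cong (degreeBelow-0 (degreeBelow-step a<1 a₀≈0) ,≈ b≈0)) norm-0R))
      return (coeff F a 0 , a₀≉0 , (degreeBelow-1 a<1 ,≈ b≈0))
      where 1≰0 : ¬ 1 ≤ 0
            1≰0 ()

  associate⇒constant : ∀ {A B U V} → ¬ A ≈ᶜ 0R → B *ᶜ U ≈ᶜ A → A *ᶜ V ≈ᶜ B →
    DoubleNegation (∃ λ a → ¬ a ≈ 0# × U ≈ᶜ (a ∷ [] , []))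
  associate⇒constant {A} {B} {U} {V} A≉0 BU≈A AV≈B = do
    VU≈1 ← *ᶜ-cancelˡ A≉0 (begin
      A *ᶜ (V *ᶜ U)   ≈⟨ CR.*-assoc A V U ⟨
      (A *ᶜ V) *ᶜ U   ≈⟨ CR.*-congʳ AV≈B ⟩
      B *ᶜ U          ≈⟨ BU≈A ⟩
      A               ≈⟨ CR.*-identityʳ A ⟨
      A *ᶜ 1R         ∎)
    unit⇒constant U V (CR.trans (CR.*-comm U V) VU≈1)
    where open Relation.Binary.Reasoning.Setoid CR.setoid

module DistinctClasses {c ℓ : Level} (F : FiniteField c ℓ) (f : Poly F) (f≉0 : ¬ Polynomials._≈ₚ_ F f []) where
  open FiniteField F using (_≈_; 0#; 1#)
  open Polynomials F
  open Degrees F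
  open CoordinateRing F xₚ
  open OddDegreeCoordinateRing F xₚ 0 degree-xₚ
  open import Data.Product using (_×_)
  open import Data.Integer using (+_)
  module R = CoordinateRing F (NPoly F f)
  open Coord F (NPoly F f) using (InIdeal₂; gen₁; gen₂)
  private
    module 𝕆 = CommutativeRing coordinateRing
    module 𝕆-Reasoning = Relation.Binary.Reasoning.Setoid 𝕆.setoid
    module 𝕆-Solver = IntegerCoefficientSolver coordinateRing
    module ℙ-Solver = IntegerCoefficientSolver polynomialRing

  ι : R.Elt → Elt
  ι (a , b) = a , b *ₚ f

  ι-cong : ∀ {z z′} → z R.≈ᶜ z′ → ι z ≈ᶜ ι z′
  ι-cong (a≈ R.,≈ b≈) = a≈ ,≈ *ₚ-congˡ f b≈

  ι-+ᶜ : ∀ z w → ι (z R.+ᶜ w) ≈ᶜ ι z +ᶜ ι w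
  ι-+ᶜ (a , b) (a′ , b′) = ≈ₚ-refl ,≈ *ₚ-distribʳ-+ₚ f b b′

  ι-*ᶜ : ∀ z w → ι (z R.*ᶜ w) ≈ᶜ ι z *ᶜ ι w
  ι-*ᶜ (a , b) (a′ , b′) =
    solve 6 (λ x f a b a′ b′ → a :* a′ :+ (x :* (f :* f)) :* (b :* b′) := a :* a′ :+ x :* ((b :* f) :* (b′ :* f)))
          ≈ₚ-refl xₚ f a b a′ b′
    ,≈ solve 5 (λ f a b a′ b′ → (a :* b′ :+ b :* a′) :* f := a :* (b′ :* f) :+ (b :* f) :* a′) ≈ₚ-refl f a b a′ b′
    where open ℙ-Solver

  ι-≉0 : ∀ {z} → ¬ z R.≈ᶜ R.0R → ¬ ι z ≈ᶜ 0R
  ι-≉0 {a , b} z≉0 (a≈0 ,≈ bf≈0) = decide (b ≈ₚ []) λ where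
    (yes b≈0) → z≉0 (a≈0 R.,≈ b≈0)
    (no b≉0)  → *ₚ-noZeroDivisors bf≈0 b≉0 f≉0

  f̂ : Elt
  f̂ = f , []

  f̂≉0 : ¬ f̂ ≈ᶜ 0R
  f̂≉0 (f≈0 ,≈ _) = f≉0 f≈0

  infix 8 w-_
  w-_ : Poly F → Elt
  w- h = -ₚ h , 1# ∷ []

  ι-gen₁ : ∀ h → ι (gen₁ (f *ₚ f) (h *ₚ f)) ≈ᶜ f̂ *ᶜ f̂
  ι-gen₁ h = solve 2 (λ x f → f :* f := f :* f :+ x :* (con (+ 0) :* con (+ 0))) ≈ₚ-refl xₚ f
          ,≈ solve 1 (λ f → con (+ 0) :* f := f :* con (+ 0) :+ con (+ 0) :* f) ≈ₚ-refl f
    where open ℙ-Solver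

  ι-gen₂ : ∀ h → ι (gen₂ (f *ₚ f) (h *ₚ f)) ≈ᶜ f̂ *ᶜ w- h
  ι-gen₂ h = solve 3 (λ x f h → :- (h :* f) := f :* (:- h) :+ x :* (con (+ 0) :* con (+ 1))) ≈ₚ-refl xₚ f h
          ,≈ solve 2 (λ f h → con (+ 1) :* f := f :* con (+ 1) :+ con (+ 0) :* (:- h)) ≈ₚ-refl f h
    where open ℙ-Solver

  -- The image in the w² = x ring of the ideal (f², y − h f), divided by f.
  InJ : Poly F → Elt → Set (c ⊔ ℓ)
  InJ h X = Σ R.Elt λ r → Σ R.Elt λ s → X ≈ᶜ ι r *ᶜ f̂ +ᶜ ι s *ᶜ w- h

  InIdeal₂⇒InJ : ∀ {γ δ h g G} → ι g ≈ᶜ f̂ *ᶜ G →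
    InIdeal₂ (γ R.*ᶜ gen₁ (f *ₚ f) (h *ₚ f)) (γ R.*ᶜ gen₂ (f *ₚ f) (h *ₚ f)) (δ R.*ᶜ g) →
    DoubleNegation (Σ Elt λ X → InJ h X × ι γ *ᶜ X ≈ᶜ ι δ *ᶜ G)
  InIdeal₂⇒InJ {γ} {δ} {h} {g} {G} ιg≈f̂G (r , s , r·γg₁+s·γg₂≈δg) = do
    γX≈δG ← *ᶜ-cancelˡ f̂≉0 f̂·γX≈f̂·δG
    return (X , (r , s , 𝕆.refl) , γX≈δG)
    where
    open 𝕆-Reasoning
    open 𝕆-Solver
    g₁ g₂ : R.Elt
    g₁ = gen₁ (f *ₚ f) (h *ₚ f)
    g₂ = gen₂ (f *ₚ f) (h *ₚ f)
    X : Elt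
    X = ι r *ᶜ f̂ +ᶜ ι s *ᶜ w- h
    f̂·γX≈f̂·δG : f̂ *ᶜ (ι γ *ᶜ X) ≈ᶜ f̂ *ᶜ (ι δ *ᶜ G)
    f̂·γX≈f̂·δG = begin
      f̂ *ᶜ (ι γ *ᶜ X)
        ≈⟨ solve 5 (λ f γ r s t → f :* (γ :* (r :* f :+ s :* t)) := r :* (γ :* (f :* f)) :+ s :* (γ :* (f :* t)))
                            𝕆.refl f̂ (ι γ) (ι r) (ι s) (w- h) ⟩
      ι r *ᶜ (ι γ *ᶜ (f̂ *ᶜ f̂)) +ᶜ ι s *ᶜ (ι γ *ᶜ (f̂ *ᶜ w- h))
        ≈⟨ 𝕆.+-cong (*ᶜ-congˡ (ι r) (*ᶜ-congˡ (ι γ) (ι-gen₁ h))) (*ᶜ-congˡ (ι s) (*ᶜ-congˡ (ι γ) (ι-gen₂ h))) ⟨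
      ι r *ᶜ (ι γ *ᶜ ι g₁) +ᶜ ι s *ᶜ (ι γ *ᶜ ι g₂)
        ≈⟨ 𝕆.+-cong (*ᶜ-congˡ (ι r) (ι-*ᶜ γ g₁)) (*ᶜ-congˡ (ι s) (ι-*ᶜ γ g₂)) ⟨
      ι r *ᶜ ι (γ R.*ᶜ g₁) +ᶜ ι s *ᶜ ι (γ R.*ᶜ g₂)
        ≈⟨ 𝕆.+-cong (ι-*ᶜ r (γ R.*ᶜ g₁)) (ι-*ᶜ s (γ R.*ᶜ g₂)) ⟨
      ι (r R.*ᶜ (γ R.*ᶜ g₁)) +ᶜ ι (s R.*ᶜ (γ R.*ᶜ g₂))
        ≈⟨ ι-+ᶜ (r R.*ᶜ (γ R.*ᶜ g₁)) (s R.*ᶜ (γ R.*ᶜ g₂)) ⟨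
      ι (r R.*ᶜ (γ R.*ᶜ g₁) R.+ᶜ s R.*ᶜ (γ R.*ᶜ g₂))
        ≈⟨ ι-cong (R.≈R⇒≈ᶜ (r R.*ᶜ (γ R.*ᶜ g₁) R.+ᶜ s R.*ᶜ (γ R.*ᶜ g₂)) (δ R.*ᶜ g) r·γg₁+s·γg₂≈δg) ⟩
      ι (δ R.*ᶜ g)                          ≈⟨ ι-*ᶜ δ g ⟩
      ι δ *ᶜ ι g                            ≈⟨ *ᶜ-congˡ (ι δ) ιg≈f̂G ⟩
      ι δ *ᶜ (f̂ *ᶜ G)                       ≈⟨ solve 3 (λ d f g → d :* (f :* g) := f :* (d :* g)) 𝕆.refl (ι δ) f̂ G ⟩
      f̂ *ᶜ (ι δ *ᶜ G)                       ∎

  f̂-*ᶜ : ∀ u v → f̂ *ᶜ (u , v) ≈ᶜ (f *ₚ u , f *ₚ v)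
  f̂-*ᶜ u v = solve 4 (λ x f u v → f :* u :+ x :* (con (+ 0) :* v) := f :* u) ≈ₚ-refl xₚ f u v
          ,≈ solve 3 (λ f u v → f :* v :+ con (+ 0) :* u := f :* v) ≈ₚ-refl f u v
    where open ℙ-Solver

  *ᶜ-w- : ∀ y₀ y₁ h → (y₀ , y₁) *ᶜ w- h ≈ᶜ (xₚ *ₚ y₁ +ₚ -ₚ (y₀ *ₚ h) , y₀ +ₚ -ₚ (y₁ *ₚ h))
  *ᶜ-w- y₀ y₁ h = solve 4 (λ x y₀ y₁ h → y₀ :* (:- h) :+ x :* (y₁ :* con (+ 1)) := x :* y₁ :- y₀ :* h) ≈ₚ-refl xₚ y₀ y₁ h
               ,≈ solve 3 (λ y₀ y₁ h → y₀ :* con (+ 1) :+ y₁ :* (:- h) := y₀ :- y₁ :* h) ≈ₚ-refl y₀ y₁ h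
    where open ℙ-Solver

  -- Since f is prime to x − h², f divides (y₀ + y₁ w)(w − h) = (x y₁ − h y₀) + (y₀ − h y₁) w
  -- only if it divides y₀ and y₁: indeed (x y₁ − h y₀) + h (y₀ − h y₁) = y₁ (x − h²).
  f̂-∣-*ᶜw- : ∀ {h Y X} → Bezout f (xₚ +ₚ -ₚ (h *ₚ h)) → Y *ᶜ w- h ≈ᶜ f̂ *ᶜ X → Σ Elt λ U → Y ≈ᶜ f̂ *ᶜ U
  f̂-∣-*ᶜw- {h} {y₀ , y₁} {X₀ , X₁} f⊥x-h² Yw-h≈f̂X = (k₀ , k₁) , 𝕆.sym (𝕆.trans (f̂-*ᶜ k₀ k₁) (fk₀≈y₀ ,≈ fk₁≈y₁))
    where
    open ≈ₚ-Reasoning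
    open ℙ-Solver
    components : (xₚ *ₚ y₁ +ₚ -ₚ (y₀ *ₚ h) , y₀ +ₚ -ₚ (y₁ *ₚ h)) ≈ᶜ (f *ₚ X₀ , f *ₚ X₁)
    components = 𝕆.trans (𝕆.sym (*ᶜ-w- y₀ y₁ h)) (𝕆.trans Yw-h≈f̂X (f̂-*ᶜ X₀ X₁))
    f∣y₁[x-h²] : f ∣ₚ y₁ *ₚ (xₚ +ₚ -ₚ (h *ₚ h))
    f∣y₁[x-h²] = X₀ +ₚ h *ₚ X₁ , (begin
      f *ₚ (X₀ +ₚ h *ₚ X₁)                  ≈⟨ solve 4 (λ f h X₀ X₁ → f :* (X₀ :+ h :* X₁) := f :* X₀ :+ h :* (f :* X₁)) ≈ₚ-refl f h X₀ X₁ ⟩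
      f *ₚ X₀ +ₚ h *ₚ (f *ₚ X₁)             ≈⟨ +ₚ-cong (≈ₚ-sym (fst≈ components)) (*ₚ-congʳ h (≈ₚ-sym (snd≈ components))) ⟩
      (xₚ *ₚ y₁ +ₚ -ₚ (y₀ *ₚ h)) +ₚ h *ₚ (y₀ +ₚ -ₚ (y₁ *ₚ h))
        ≈⟨ solve 4 (λ x h y₀ y₁ → (x :* y₁ :- y₀ :* h) :+ h :* (y₀ :- y₁ :* h) := y₁ :* (x :- h :* h)) ≈ₚ-refl xₚ h y₀ y₁ ⟩
      y₁ *ₚ (xₚ +ₚ -ₚ (h *ₚ h))             ∎)
    f∣y₁ : f ∣ₚ y₁
    f∣y₁ = bezout-∣ₚ {y = y₁} f⊥x-h² f∣y₁[x-h²]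
    k₁ k₀ : Poly F
    k₁ = proj₁ f∣y₁
    k₀ = X₁ +ₚ k₁ *ₚ h
    fk₁≈y₁ : f *ₚ k₁ ≈ₚ y₁
    fk₁≈y₁ = proj₂ f∣y₁
    fk₀≈y₀ : f *ₚ k₀ ≈ₚ y₀
    fk₀≈y₀ = begin
      f *ₚ (X₁ +ₚ k₁ *ₚ h)                  ≈⟨ solve 4 (λ f h X₁ k₁ → f :* (X₁ :+ k₁ :* h) := f :* X₁ :+ (f :* k₁) :* h) ≈ₚ-refl f h X₁ k₁ ⟩
      f *ₚ X₁ +ₚ (f *ₚ k₁) *ₚ h             ≈⟨ +ₚ-cong (≈ₚ-sym (snd≈ components)) (*ₚ-congˡ h fk₁≈y₁) ⟩
      (y₀ +ₚ -ₚ (y₁ *ₚ h)) +ₚ y₁ *ₚ h       ≈⟨ solve 3 (λ h y₀ y₁ → (y₀ :- y₁ :* h) :+ y₁ :* h := y₀) ≈ₚ-refl h y₀ y₁ ⟩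
      y₀                                    ∎

  exactQuotient : ∀ {A B Y X h} → ¬ A ≈ᶜ 0R → ¬ B ≈ᶜ 0R → Bezout f (xₚ +ₚ -ₚ (h *ₚ h)) →
    B *ᶜ Y ≈ᶜ A *ᶜ f̂ → B *ᶜ X ≈ᶜ A *ᶜ w- h → DoubleNegation (Σ Elt λ U → B *ᶜ U ≈ᶜ A)
  exactQuotient {A} {B} {Y} {X} {h} A≉0 B≉0 f⊥x-h² BY≈Af̂ BX≈Aw-h = do
    Yw-h≈f̂X ← *ᶜ-cancelˡ (*ᶜ-≉0 A≉0 B≉0) AB·Yw-h≈AB·f̂X
    let (U , Y≈f̂U) = f̂-∣-*ᶜw- f⊥x-h² Yw-h≈f̂X
    BU≈A ← *ᶜ-cancelˡ f̂≉0 (f̂·BU≈f̂·A Y≈f̂U)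
    return (U , BU≈A)
    where
    open 𝕆-Reasoning
    open 𝕆-Solver
    AB·Yw-h≈AB·f̂X : (A *ᶜ B) *ᶜ (Y *ᶜ w- h) ≈ᶜ (A *ᶜ B) *ᶜ (f̂ *ᶜ X)
    AB·Yw-h≈AB·f̂X = begin
      (A *ᶜ B) *ᶜ (Y *ᶜ w- h)   ≈⟨ solve 4 (λ a b y t → (a :* b) :* (y :* t) := (b :* y) :* (a :* t)) 𝕆.refl A B Y (w- h) ⟩
      (B *ᶜ Y) *ᶜ (A *ᶜ w- h)   ≈⟨ 𝕆.*-cong BY≈Af̂ (𝕆.sym BX≈Aw-h) ⟩
      (A *ᶜ f̂) *ᶜ (B *ᶜ X)      ≈⟨ solve 4 (λ a b f x → (a :* f) :* (b :* x) := (a :* b) :* (f :* x)) 𝕆.refl A B f̂ X ⟩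
      (A *ᶜ B) *ᶜ (f̂ *ᶜ X)      ∎
    f̂·BU≈f̂·A : ∀ {U} → Y ≈ᶜ f̂ *ᶜ U → f̂ *ᶜ (B *ᶜ U) ≈ᶜ f̂ *ᶜ A
    f̂·BU≈f̂·A {U} Y≈f̂U = begin
      f̂ *ᶜ (B *ᶜ U)   ≈⟨ solve 3 (λ f b u → f :* (b :* u) := b :* (f :* u)) 𝕆.refl f̂ B U ⟩
      B *ᶜ (f̂ *ᶜ U)   ≈⟨ *ᶜ-congˡ B Y≈f̂U ⟨
      B *ᶜ Y          ≈⟨ BY≈Af̂ ⟩
      A *ᶜ f̂          ≈⟨ 𝕆.*-comm A f̂ ⟩
      f̂ *ᶜ A          ∎

  ev : Poly F → Elt → Poly F
  ev h (u , v) = u +ₚ h *ₚ v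

  ev-cong : ∀ h {X X′} → X ≈ᶜ X′ → ev h X ≈ₚ ev h X′
  ev-cong h (u≈ ,≈ v≈) = +ₚ-cong u≈ (*ₚ-congʳ h v≈)

  -- ev h (p (w − h)) = 0, and all other terms of ι r f + ι s (w − h) have coefficients divisible by f.
  InJ⇒f∣ev : ∀ {h X} → InJ h X → f ∣ₚ ev h X
  InJ⇒f∣ev {h} {X} ((a , b) , (p , q) , X≈) = a +ₚ xₚ *ₚ q +ₚ h *ₚ b *ₚ f +ₚ -ₚ (h *ₚ h *ₚ q) , (begin
    f *ₚ (a +ₚ xₚ *ₚ q +ₚ h *ₚ b *ₚ f +ₚ -ₚ (h *ₚ h *ₚ q))
      ≈⟨ solve 7 (λ x f h a b p q → f :* (a :+ x :* q :+ h :* b :* f :- h :* h :* q)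
                                 := ((a :* f :+ x :* ((b :* f) :* con (+ 0))) :+ (p :* (:- h) :+ x :* ((q :* f) :* con (+ 1))))
                                    :+ h :* ((a :* con (+ 0) :+ (b :* f) :* f) :+ (p :* con (+ 1) :+ (q :* f) :* (:- h))))
               ≈ₚ-refl xₚ f h a b p q ⟩
      ev h (ι (a , b) *ᶜ f̂ +ᶜ ι (p , q) *ᶜ w- h)  ≈⟨ ev-cong h X≈ ⟨
      ev h X                                      ∎)
    where
    open ≈ₚ-Reasoning
    open ℙ-Solver

  ev-const-*ᶜ-w- : ∀ a h₁ h₂ → ev h₂ ((a ∷ [] , []) *ᶜ w- h₁) ≈ₚ (a ∷ []) *ₚ (h₂ +ₚ -ₚ h₁)
  ev-const-*ᶜ-w- a h₁ h₂ =
    solve 4 (λ x a h₁ h₂ → (a :* (:- h₁) :+ x :* (con (+ 0) :* con (+ 1))) :+ h₂ :* (a :* con (+ 1) :+ con (+ 0) :* (:- h₁))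
                        := a :* (h₂ :- h₁)) ≈ₚ-refl xₚ (a ∷ []) h₁ h₂
    where open ℙ-Solver

  sameClass⇒f∣h₂-h₁ : ∀ {h₁ h₂} → Bezout f (xₚ +ₚ -ₚ (h₁ *ₚ h₁)) → Bezout f (xₚ +ₚ -ₚ (h₂ *ₚ h₂)) →
    ClassEqN F f (f *ₚ f) (h₁ *ₚ f) (f *ₚ f) (h₂ *ₚ f) → DoubleNegation (f ∣ₚ h₂ +ₚ -ₚ h₁)
  sameClass⇒f∣h₂-h₁ {h₁} {h₂} f⊥x-h₁² f⊥x-h₂² (α , β , α≉0 , β≉0 , (αg₁∈ , αg₂∈) , (βg₁∈ , βg₂∈)) = do
    (Y  , _   , BY≈Af̂)     ← InIdeal₂⇒InJ {β} {α} {h₂} (ι-gen₁ h₁) αg₁∈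
    (X  , X∈J , BX≈Aw-h₁)  ← InIdeal₂⇒InJ {β} {α} {h₂} (ι-gen₂ h₁) αg₂∈
    (Y′ , _   , AY′≈Bf̂)    ← InIdeal₂⇒InJ {α} {β} {h₁} (ι-gen₁ h₂) βg₁∈
    (X′ , _   , AX′≈Bw-h₂) ← InIdeal₂⇒InJ {α} {β} {h₁} (ι-gen₂ h₂) βg₂∈
    (U , BU≈A) ← exactQuotient A≉0 B≉0 f⊥x-h₁² BY≈Af̂ BX≈Aw-h₁
    (V , AV≈B) ← exactQuotient B≉0 A≉0 f⊥x-h₂² AY′≈Bf̂ AX′≈Bw-h₂
    (a , a≉0 , U≈a) ← associate⇒constant A≉0 BU≈A AV≈B
    X≈a·w-h₁ ← *ᶜ-cancelˡ B≉0 (begin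
      B *ᶜ X                      ≈⟨ BX≈Aw-h₁ ⟩
      A *ᶜ w- h₁                  ≈⟨ *ᶜ-congʳ (w- h₁) BU≈A ⟨
      (B *ᶜ U) *ᶜ w- h₁           ≈⟨ 𝕆.*-assoc B U (w- h₁) ⟩
      B *ᶜ (U *ᶜ w- h₁)           ≈⟨ *ᶜ-congˡ B (*ᶜ-congʳ (w- h₁) U≈a) ⟩
      B *ᶜ ((a ∷ [] , []) *ᶜ w- h₁) ∎)
    return (∣ₚ-const-*ₚ {f} a≉0 (∣ₚ-resp-≈ₚ {f} (≈ₚ-trans (ev-cong h₂ X≈a·w-h₁) (ev-const-*ᶜ-w- a h₁ h₂)) (InJ⇒f∣ev {h₂} X∈J)))
    where
    open 𝕆-Reasoning
    A B : Elt
    A = ι α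
    B = ι β
    A≉0 : ¬ A ≈ᶜ 0R
    A≉0 = ι-≉0 {α} (λ α≈0 → α≉0 (R.≈ᶜ⇒≈R α≈0))
    B≉0 : ¬ B ≈ᶜ 0R
    B≉0 = ι-≉0 {β} (λ β≈0 → β≉0 (R.≈ᶜ⇒≈R β≈0))

lemma3 : {c ℓ : Level} (F : FiniteField c ℓ) → CharNot2 F →
    (f h₁ h₂ : Poly F) → Irreducible F f →
    DegLt F h₁ f → DegLt F h₂ f →
    GcdOne F f (_+P_ F (xP F) (-P_ F (_*P_ F h₁ h₁))) →
    GcdOne F f (_+P_ F (xP F) (-P_ F (_*P_ F h₂ h₂))) →
    ¬ (_≋_ F h₁ h₂) →
    ¬ ClassEqN F f (_*P_ F f f) (_*P_ F h₁ f) (_*P_ F f f) (_*P_ F h₂ f)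
lemma3 F _ f h₁ h₂ (f≢0 , _) h₁<f h₂<f gcd[f,x-h₁²]≈1 gcd[f,x-h₂²]≈1 h₁≢h₂ sameClass =
  ¬¬h₂-h₁≈0 λ h₂-h₁≈0 → h₁≢h₂ (at (≈ₚ-sym (p-q≈[]⇒p≈q {h₂} {h₁} h₂-h₁≈0)))
  where
  open Polynomials F
  open Degrees F
  f≉0 : ¬ f ≈ₚ []
  f≉0 f≈0 = f≢0 (at f≈0)
  open DistinctClasses F f f≉0
  ¬¬h₂-h₁≈0 : DoubleNegation (h₂ +ₚ -ₚ h₁ ≈ₚ [])
  ¬¬h₂-h₁≈0 = do
    f⊥x-h₁² ← bezout f (xₚ +ₚ -ₚ (h₁ *ₚ h₁)) gcd[f,x-h₁²]≈1 f≉0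
    f⊥x-h₂² ← bezout f (xₚ +ₚ -ₚ (h₂ *ₚ h₂)) gcd[f,x-h₂²]≈1 f≉0
    f∣h₂-h₁ ← sameClass⇒f∣h₂-h₁ {h₁} {h₂} f⊥x-h₁² f⊥x-h₂² sameClass
    ∣ₚ∧DegLt⇒≈[] f≉0 f∣h₂-h₁ (DegLt-sub {h₂} {h₁} {f} h₂<f h₁<f)
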